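{- For every $k\ge 1$, the Narayana polynomial $N_k(t)=\sum_{m=1}^{k}N_{k,m}t^m$, where $N_{k,m}=\frac{1}{k}\binom{k}{m}\binom{k}{m-1}$, is $\gamma$-positive, with expansion $$N_k(t)=\sum_{j=1}^{\lfloor (k+1)/2\rfloor}\gamma^N_{k,j}\,t^j(1+t)^{k+1-2j},$$ where $$\gamma^N_{k,j}=\left|\{c\in\mathsf{DComp}_{k,j}:\mathsf{Dnu}(c)=\varnothing\}\right|=\left|\{c\in\mathsf{DComp}_{k,k-j+1}:\mathsf{Do}(c)=\varnothing\}\right|.$$
   Context: For a sequence $c=(c_1,\ldots,c_l)$ of positive integers and $i\le j$, $f(c;i,j)=\sum_{t=i}^{j}(c_t-2)$. A composition $c=(c_1,\ldots,c_l)$ is dominating if $f(c;1,i)>0$ for all $1\le i\le l$. $\mathsf{DComp}_{k,m}$ denotes the set of dominating compositions of $2k+1$ into exactly $k$ parts having exactly $m$ parts larger than $1$. For $c\in\mathsf{DComp}_{k,m}$ set $c_{k+1}:=1$; $\mathsf{Dnu}(c)$ is the set of parts $c_i$ ($1\le i\le k$) with $c_i>1$ and $c_{i+1}>1$, and $\mathsf{Do}(c)$ is the set of parts $c_i$ ($1\le i\le k$) with $c_i=1$ and $c_{i+1}=1$. -}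

module Defs where

open import Data.Nat using (ℕ; zero; suc; _+_; _*_; _∸_; _≤_; _<_; _≤?_; NonZero)
open import Data.Nat.DivMod using (_/_)
open import Data.Nat.Combinatorics using (_C_)
open import Data.Integer as ℤ using (ℤ; +_; _-_)
open import Data.List using (List; []; _∷_; length; filter)
open import Data.Nat.ListAction using (sum)
open import Data.List.Relation.Unary.All using (All)
open import Data.List.Relation.Unary.Unique.Propositional using (Unique)
open import Data.List.Membership.Propositional using (_∈_)
open import Data.Product using (Σ; _×_)
open import Function.Bundles using (_⇔_)
open import Relation.Nullary using (¬_)
open import Relation.Binary.PropositionalEquality using (_≡_)

sumTo : ℕ → (ℕ → ℕ) → ℕ
sumTo zero    f = 0
sumTo (suc n) f = sumTo n f + f n

-- sumFromTo a b f = Σ_{i=a}^{b} f i   (empty if b < a)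
sumFromTo : ℕ → ℕ → (ℕ → ℕ) → ℕ
sumFromTo a b f = sumTo (suc b ∸ a) (λ i → f (a + i))

sumToℤ : ℕ → (ℕ → ℤ) → ℤ
sumToℤ zero    f = + 0
sumToℤ (suc n) f = sumToℤ n f ℤ.+ f n

sumFromToℤ : ℕ → ℕ → (ℕ → ℤ) → ℤ
sumFromToℤ a b f = sumToℤ (suc b ∸ a) (λ i → f (a + i))

-- Polynomials in t with ℕ coefficients, as coefficient sequences
-- (p n = coefficient of t^n).

Poly : Set
Poly = ℕ → ℕ

_≈ₚ_ : Poly → Poly → Set
p ≈ₚ q = ∀ n → p n ≡ q n

_⊕_ : Poly → Poly → Poly
(p ⊕ q) n = p n + q n

_⊛_ : Poly → Poly → Poly
(p ⊛ q) n = sumTo (suc n) (λ i → p i * q (n ∸ i))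

constP : ℕ → Poly
constP c zero    = c
constP c (suc n) = 0

tP : Poly
tP (suc zero) = 1
tP _          = 0

_^ₚ_ : Poly → ℕ → Poly
p ^ₚ zero  = constP 1
p ^ₚ suc n = p ⊛ (p ^ₚ n)

_·ₚ_ : ℕ → Poly → Poly
(c ·ₚ p) n = c * p n

sumP : ℕ → ℕ → (ℕ → Poly) → Poly
sumP a b P n = sumFromTo a b (λ i → P i n)

narayana : (k : ℕ) → .{{NonZero k}} → ℕ → ℕ
narayana k m = ((k C m) * (k C (m ∸ 1))) / k

narayanaPoly : (k : ℕ) → .{{NonZero k}} → Poly
narayanaPoly k = sumP 1 k (λ m → narayana k m ·ₚ (tP ^ₚ m))

-- 1-based lookup with a default value for out-of-range indices
nthD : ℕ → List ℕ → ℕ → ℕ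
nthD d []       i             = d
nthD d (x ∷ xs) zero          = d
nthD d (x ∷ xs) (suc zero)    = x
nthD d (x ∷ xs) (suc (suc i)) = nthD d xs (suc i)

IsComposition : ℕ → ℕ → List ℕ → Set
IsComposition n l c = All (λ x → 1 ≤ x) c × sum c ≡ n × length c ≡ l

fc : List ℕ → ℕ → ℕ → ℤ
fc c i j = sumFromToℤ i j (λ t → + nthD 0 c t - + 2)

Dominating : List ℕ → Set
Dominating c = ∀ i → 1 ≤ i → i ≤ length c → + 0 ℤ.< fc c 1 i

numBig : List ℕ → ℕ
numBig c = length (filter (2 ≤?_) c)

DComp : ℕ → ℕ → List ℕ → Set
DComp k m c = IsComposition (2 * k + 1) k c × Dominating c × numBig c ≡ m

-- with the convention c_{k+1} := 1 (k = length c)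
cext : List ℕ → ℕ → ℕ
cext c = nthD 1 c

-- index i contributes c_i to Dnu(c)
InDnu : List ℕ → ℕ → Set
InDnu c i = 1 ≤ i × i ≤ length c × 1 < cext c i × 1 < cext c (suc i)

-- index i contributes c_i to Do(c)
InDo : List ℕ → ℕ → Set
InDo c i = 1 ≤ i × i ≤ length c × cext c i ≡ 1 × cext c (suc i) ≡ 1

DnuEmpty : List ℕ → Set
DnuEmpty c = ∀ i → ¬ InDnu c i

DoEmpty : List ℕ → Set
DoEmpty c = ∀ i → ¬ InDo c i

HasSize : (List ℕ → Set) → ℕ → Set
HasSize P n = Σ (List (List ℕ)) λ l → Unique l × (∀ c → (c ∈ l) ⇔ P c) × length l ≡ n

module Submission where

-- Lowering the first part by one and appending a part 1 turns a dominating composition of 2k + 1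
-- into k parts into a composition of 2k + 1 into k + 1 parts all of whose proper prefixes of
-- length t sum to at least 2t; Dnu = ∅ (resp. Do = ∅) becomes the condition that no two
-- cyclically adjacent parts are > 1 (resp. = 1).  By the cycle lemma exactly one of the k + 1
-- rotations of such a composition has the prefix property, so both sets have
-- #(cyclic patterns) · binom (k - 1) (j - 1) / (k + 1) elements.  Comparing coefficients, the
-- expansion of N_k(t) reduces via Vandermonde's convolution to a multinomial identity.

open import Defs
open import Level using (0ℓ)
open import Data.Nat using (ℕ; zero; suc; pred; _+_; _*_; _∸_; _≤_; _<_; z≤n; s≤s; s≤s⁻¹; _≟_; _≤?_; _<?_; _⊓_; _!; NonZero)
open import Data.Nat.Properties
open import Data.Nat.DivMod using (_/_; m/n*n≤m; m*n/n≡m; /-monoˡ-≤)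
open import Data.Nat.Combinatorics using (_C_; nCk+nC[k+1]≡[n+1]C[k+1])
open import Data.Nat.Combinatorics.Specification using (k>n⇒nCk≡0)
open import Data.Nat.ListAction using (sum)
open import Data.Nat.ListAction.Properties using (sum-++)
open import Data.Nat.Tactic.RingSolver using (solve-∀)
open import Data.Integer as ℤ using (_-_)
import Data.Integer.Properties as ℤ
import Data.Integer.Tactic.RingSolver as ℤ-Solver
open import Data.Bool using (Bool; true; false; _∧_; not; if_then_else_)
open import Data.Bool.Properties using (not-involutive; ∧-zeroʳ)
open import Data.List using (List; []; _∷_; length; map; _++_; take; drop; filter; upTo; cartesianProduct; initLast; _∷ʳ′_)
open import Data.List.Properties
  using (length-map; length-++; length-++-≤ˡ; length-upTo; length-take; length-drop; map-∘; map-id; map-cong; map-++;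
         ++-assoc; ++-identityʳ; take++drop≡id)
open import Data.List.Relation.Unary.All using (All; []; _∷_)
import Data.List.Relation.Unary.All.Properties as All
open import Data.List.Relation.Unary.Any using (here; there)
open import Data.List.Relation.Unary.Unique.Propositional using (Unique; []; _∷_)
import Data.List.Relation.Unary.Unique.Propositional.Properties as Unique
open import Data.List.Membership.Propositional using (_∈_)
open import Data.List.Membership.Propositional.Properties
  using (∈-map⁺; ∈-map⁻; ∈-++⁺ˡ; ∈-++⁺ʳ; ∈-++⁻; ∈-cartesianProduct⁺; ∈-cartesianProduct⁻;
         ∈-filter⁺; ∈-filter⁻; ∈-upTo⁺; ∈-upTo⁻)
open import Data.List.Membership.Propositional.Properties.WithK using (unique∧set⇒bag)
open import Data.List.Relation.Binary.BagAndSetEquality using (∼bag⇒↭)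
open import Data.List.Relation.Binary.Permutation.Propositional.Properties using (↭-length)
open import Data.Product using (Σ; ∃; ∃₂; _×_; _,_; proj₁; proj₂; uncurry)
open import Data.Sum using (_⊎_; inj₁; inj₂; [_,_])
open import Data.Empty using (⊥; ⊥-elim)
open import Data.Unit using (⊤)
open import Function using (_∘_; id)
open import Function.Bundles using (_⇔_; mk⇔; Equivalence)
open import Function.Properties.Equivalence using (⇔-setoid)
open import Relation.Nullary using (¬_; Dec; yes; no)
open import Relation.Nullary.Decidable using (_→-dec_)
open import Relation.Unary using (Decidable)
open import Relation.Binary.PropositionalEquality
  using (_≡_; _≢_; refl; sym; trans; cong; cong₂; subst; subst₂; module ≡-Reasoning)

open Equivalence using (to; from)

-- Counting finite sets

Card : {A : Set} → (A → Set) → ℕ → Set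
Card {A} P n = Σ (List A) λ xs → Unique xs × (∀ x → x ∈ xs ⇔ P x) × length xs ≡ n

module _ {A : Set} {P Q : A → Set} where

  Card-resp-⇔ : ∀ {n} → (∀ x → P x ⇔ Q x) → Card P n → Card Q n
  Card-resp-⇔ P⇔Q (xs , u , mem , len) =
    xs , u , (λ x → mk⇔ (to (P⇔Q x) ∘ to (mem x)) (from (mem x) ∘ from (P⇔Q x))) , len

  Card-⊎ : ∀ {m n} → (∀ x → P x → Q x → ⊥) → Card P m → Card Q n → Card (λ x → P x ⊎ Q x) (m + n)
  Card-⊎ disjoint (xs , u , mem , refl) (ys , v , mem′ , refl) =
    xs ++ ys , Unique.++⁺ u v (λ (x∈xs , x∈ys) → disjoint _ (to (mem _) x∈xs) (to (mem′ _) x∈ys)) ,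
    (λ x → mk⇔ ([ inj₁ ∘ to (mem x) , inj₂ ∘ to (mem′ x) ] ∘ ∈-++⁻ xs)
               [ ∈-++⁺ˡ ∘ from (mem x) , ∈-++⁺ʳ xs ∘ from (mem′ x) ]) ,
    length-++ xs

  Card-∩ : ∀ {n} → Decidable Q → Card P n → ∃ λ m → Card (λ x → P x × Q x) m
  Card-∩ Q? (xs , u , mem , _) =
    _ , filter Q? xs , Unique.filter⁺ Q? u ,
    (λ x → mk⇔ (λ x∈ → let (x∈xs , qx) = ∈-filter⁻ Q? x∈ in to (mem x) x∈xs , qx)
               (λ (px , qx) → ∈-filter⁺ Q? (from (mem x) px) qx)) ,
    refl

module _ {A : Set} {P : A → Set} where

  Card-unique : ∀ {m n} → Card P m → Card P n → m ≡ n
  Card-unique (xs , u , mem , refl) (ys , v , mem′ , refl) =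
    ↭-length (∼bag⇒↭ (unique∧set⇒bag u v (λ {x} → mk⇔ (from (mem′ x) ∘ to (mem x)) (from (mem x) ∘ to (mem′ x)))))

  Card-∅ : (∀ x → ¬ P x) → Card P 0
  Card-∅ ¬P = [] , [] , (λ x → mk⇔ (λ ()) (⊥-elim ∘ ¬P x)) , refl

  Card-singleton : ∀ x → P x → (∀ y → P y → y ≡ x) → Card P 1
  Card-singleton x px only = x ∷ [] , [] ∷ [] , (λ y → mk⇔ (λ { (here refl) → px }) (here ∘ only y)) , refl

Card-< : ∀ n → Card (_< n) n
Card-< n = upTo n , Unique.upTo⁺ n , (λ i → mk⇔ ∈-upTo⁻ ∈-upTo⁺) , length-upTo n

module _ {A B : Set} {P : A → Set} (f : A → B)
         (f-injective : ∀ {x y} → P x → P y → f x ≡ f y → x ≡ y) where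

  Unique-map⁺-on : ∀ {xs} → All P xs → Unique xs → Unique (map f xs)
  Unique-map⁺-on []         []         = []
  Unique-map⁺-on {x ∷ _} (px ∷ pxs) (x∉ ∷ u) = distinct pxs x∉ ∷ Unique-map⁺-on pxs u
    where
    distinct : ∀ {ys} → All P ys → All (λ y → ¬ x ≡ y) ys → All (λ z → ¬ f x ≡ z) (map f ys)
    distinct []         []         = []
    distinct (py ∷ pys) (x≢y ∷ ns) = (λ fx≡fy → x≢y (f-injective px py fx≡fy)) ∷ distinct pys ns

  Card-image : ∀ {Q : B → Set} {n} → (∀ x → P x → Q (f x)) → (∀ y → Q y → ∃ λ x → P x × y ≡ f x) →
               Card P n → Card Q n
  Card-image {Q} into onto (xs , u , mem , len) =
    map f xs , Unique-map⁺-on (all-P xs λ x∈ → to (mem _) x∈) u ,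
    (λ y → mk⇔ (image y ∘ ∈-map⁻ f) (preimage y)) ,
    trans (length-map f xs) len
    where
    all-P : ∀ ys → (∀ {y} → y ∈ ys → P y) → All P ys
    all-P []       _  = []
    all-P (y ∷ ys) h = h (here refl) ∷ all-P ys (h ∘ there)
    image : ∀ y → (∃ λ x → x ∈ xs × y ≡ f x) → Q y
    image _ (x , x∈ , refl) = into x (to (mem x) x∈)
    preimage : ∀ y → Q y → y ∈ map f xs
    preimage y qy with onto y qy
    ... | x , px , refl = ∈-map⁺ f (from (mem x) px)

Card-inverse : ∀ {A B : Set} {P : A → Set} {Q : B → Set} {n} (f : A → B) (g : B → A) →
               (∀ x → P x → Q (f x)) → (∀ y → Q y → P (g y)) →
               (∀ x → P x → g (f x) ≡ x) → (∀ y → Q y → f (g y) ≡ y) →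
               Card P n → Card Q n
Card-inverse f g into back g∘f f∘g =
  Card-image f (λ {x} {y} px py eq → trans (sym (g∘f x px)) (trans (cong g eq) (g∘f y py))) into
    (λ y qy → g y , back y qy , sym (f∘g y qy))

length-cartesianProduct : ∀ {A B : Set} (xs : List A) (ys : List B) →
                          length (cartesianProduct xs ys) ≡ length xs * length ys
length-cartesianProduct []       ys = refl
length-cartesianProduct (x ∷ xs) ys =
  trans (length-++ (map (x ,_) ys)) (cong₂ _+_ (length-map (x ,_) ys) (length-cartesianProduct xs ys))

Card-× : ∀ {A B : Set} {P : A → Set} {Q : B → Set} {m n} →
         Card P m → Card Q n → Card (λ (x , y) → P x × Q y) (m * n)
Card-× (xs , u , mem , refl) (ys , v , mem′ , refl) =
  cartesianProduct xs ys , Unique.cartesianProduct⁺ u v ,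
  (λ (x , y) → mk⇔ (λ xy∈ → let (x∈ , y∈) = ∈-cartesianProduct⁻ xs ys xy∈ in to (mem x) x∈ , to (mem′ y) y∈)
                   (λ (px , qy) → ∈-cartesianProduct⁺ (from (mem x) px) (from (mem′ y) qy))) ,
  length-cartesianProduct xs ys

-- Finite sums and binomial coefficients

sumTo-cong : ∀ n {f g : ℕ → ℕ} → (∀ i → i < n → f i ≡ g i) → sumTo n f ≡ sumTo n g
sumTo-cong zero    f≗g = refl
sumTo-cong (suc n) f≗g = cong₂ _+_ (sumTo-cong n λ i i<n → f≗g i (m<n⇒m<1+n i<n)) (f≗g n ≤-refl)

sumTo-+ : ∀ n f g → sumTo n (λ i → f i + g i) ≡ sumTo n f + sumTo n g
sumTo-+ zero    f g = refl
sumTo-+ (suc n) f g = begin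
  sumTo n (λ i → f i + g i) + (f n + g n) ≡⟨ cong (_+ (f n + g n)) (sumTo-+ n f g) ⟩
  sumTo n f + sumTo n g + (f n + g n)     ≡⟨ +-+-swap (sumTo n f) (sumTo n g) (f n) (g n) ⟩
  sumTo n f + f n + (sumTo n g + g n)     ∎
  where
  open ≡-Reasoning
  +-+-swap : ∀ a b c d → a + b + (c + d) ≡ a + c + (b + d)
  +-+-swap = solve-∀

sumTo-*ˡ : ∀ n c f → sumTo n (λ i → c * f i) ≡ c * sumTo n f
sumTo-*ˡ zero    c f = sym (*-zeroʳ c)
sumTo-*ˡ (suc n) c f = trans (cong (_+ c * f n) (sumTo-*ˡ n c f)) (sym (*-distribˡ-+ c (sumTo n f) (f n)))

sumTo-suc : ∀ n f → sumTo (suc n) f ≡ f 0 + sumTo n (λ i → f (suc i))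
sumTo-suc zero    f = sym (+-identityʳ (f 0))
sumTo-suc (suc n) f = trans (cong (_+ f (suc n)) (sumTo-suc n f)) (+-assoc (f 0) _ (f (suc n)))

sumTo-zero : ∀ n {f} → (∀ i → i < n → f i ≡ 0) → sumTo n f ≡ 0
sumTo-zero zero    f≡0 = refl
sumTo-zero (suc n) f≡0 = cong₂ _+_ (sumTo-zero n λ i i<n → f≡0 i (m<n⇒m<1+n i<n)) (f≡0 n ≤-refl)

sumTo-single : ∀ n {f} t → (∀ i → i ≢ t → f i ≡ 0) → t < n → sumTo n f ≡ f t
sumTo-single (suc n) {f} t f≡0 t<1+n with t ≟ n
... | yes refl = cong (_+ f t) (sumTo-zero t λ i i<t → f≡0 i (<⇒≢ i<t))
... | no t≢n   = trans (cong₂ _+_ (sumTo-single n t f≡0 (≤∧≢⇒< (s≤s⁻¹ t<1+n) t≢n)) (f≡0 n (t≢n ∘ sym)))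
                       (+-identityʳ (f t))

sumTo-truncate : ∀ m n {f} → m ≤ n → (∀ i → m ≤ i → f i ≡ 0) → sumTo n f ≡ sumTo m f
sumTo-truncate m zero    z≤n  _   = refl
sumTo-truncate m (suc n) m≤1+n f≡0 with m ≟ suc n
... | yes refl = refl
... | no m≢1+n = trans (cong₂ _+_ (sumTo-truncate m n m≤n f≡0) (f≡0 n m≤n)) (+-identityʳ _)
  where m≤n = s≤s⁻¹ (≤∧≢⇒< m≤1+n m≢1+n)

binom : ℕ → ℕ → ℕ
binom n       zero    = 1
binom zero    (suc k) = 0
binom (suc n) (suc k) = binom n k + binom n (suc k)

binom≡C : ∀ n k → binom n k ≡ n C k
binom≡C n       zero    = refl
binom≡C zero    (suc k) = sym (k>n⇒nCk≡0 {0} {suc k} (s≤s z≤n))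
binom≡C (suc n) (suc k) = trans (cong₂ _+_ (binom≡C n k) (binom≡C n (suc k))) (nCk+nC[k+1]≡[n+1]C[k+1] n k)

binom-> : ∀ {n k} → n < k → binom n k ≡ 0
binom-> {zero}  {suc k} _       = refl
binom-> {suc n} {suc k} n<k = cong₂ _+_ (binom-> (s≤s⁻¹ n<k)) (binom-> (m<n⇒m<1+n (s≤s⁻¹ n<k)))

binom-diag : ∀ n → binom n n ≡ 1
binom-diag zero    = refl
binom-diag (suc n) = cong₂ _+_ (binom-diag n) (binom-> (n<1+n n))

binom-absorb : ∀ n k → suc k * binom (suc n) (suc k) ≡ suc n * binom n k
binom-absorb zero    zero    = refl
binom-absorb zero    (suc k) = *-zeroʳ (suc (suc k))
binom-absorb (suc n) zero    = trans (+-identityʳ (binom (suc (suc n)) 1)) (trans (binom-one (suc (suc n))) (sym (*-identityʳ (suc (suc n)))))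
  where
  binom-one : ∀ n → binom n 1 ≡ n
  binom-one zero    = refl
  binom-one (suc n) = cong suc (binom-one n)
binom-absorb (suc n) (suc k) = begin
  suc (suc k) * (binom (suc n) (suc k) + binom (suc n) (suc (suc k)))
    ≡⟨ *-distribˡ-+ (suc (suc k)) (binom (suc n) (suc k)) (binom (suc n) (suc (suc k))) ⟩
  suc (suc k) * binom (suc n) (suc k) + suc (suc k) * binom (suc n) (suc (suc k))
    ≡⟨ cong₂ (λ x y → binom (suc n) (suc k) + x + y) (binom-absorb n k) (binom-absorb n (suc k)) ⟩
  binom (suc n) (suc k) + suc n * binom n k + suc n * binom n (suc k)
    ≡⟨ +-assoc (binom (suc n) (suc k)) (suc n * binom n k) (suc n * binom n (suc k)) ⟩
  binom (suc n) (suc k) + (suc n * binom n k + suc n * binom n (suc k))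
    ≡⟨ cong (binom (suc n) (suc k) +_) (*-distribˡ-+ (suc n) (binom n k) (binom n (suc k))) ⟨
  suc (suc n) * binom (suc n) (suc k) ∎
  where open ≡-Reasoning

binom-sym : ∀ a b → binom (a + b) a ≡ binom (a + b) b
binom-sym zero    b       = sym (binom-diag b)
binom-sym (suc a) zero    = trans (cong (λ n → binom n (suc a)) (+-identityʳ (suc a))) (binom-diag (suc a))
binom-sym (suc a) (suc b) = begin
  binom (a + suc b) a + binom (a + suc b) (suc a)
    ≡⟨ cong₂ _+_ (binom-sym a (suc b)) (cong (λ n → binom n (suc a)) (+-suc a b)) ⟩
  binom (a + suc b) (suc b) + binom (suc a + b) (suc a)
    ≡⟨ cong (binom (a + suc b) (suc b) +_) (trans (binom-sym (suc a) b) (cong (λ n → binom n b) (sym (+-suc a b)))) ⟩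
  binom (a + suc b) (suc b) + binom (a + suc b) b
    ≡⟨ +-comm (binom (a + suc b) (suc b)) _ ⟩
  binom (a + suc b) b + binom (a + suc b) (suc b) ∎
  where open ≡-Reasoning

binom-absorb-pascal : ∀ a b → suc a * (binom (suc b) (suc a) + binom b a) ≡ suc (suc (a + b)) * binom b a
binom-absorb-pascal a b = begin
  suc a * (binom (suc b) (suc a) + binom b a)             ≡⟨ *-distribˡ-+ (suc a) (binom (suc b) (suc a)) (binom b a) ⟩
  suc a * binom (suc b) (suc a) + suc a * binom b a       ≡⟨ cong (_+ suc a * binom b a) (binom-absorb b a) ⟩
  suc b * binom b a + suc a * binom b a                   ≡⟨ *-distribʳ-+ (binom b a) (suc b) (suc a) ⟨
  (suc b + suc a) * binom b a                             ≡⟨ cong (λ n → suc n * binom b a) (trans (+-suc b a) (cong suc (+-comm b a))) ⟩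
  suc (suc (a + b)) * binom b a                           ∎
  where open ≡-Reasoning

binom-absorb-sym : ∀ p q → suc q * binom (suc (p + q)) p ≡ suc (p + q) * binom (p + q) p
binom-absorb-sym p q = begin
  suc q * binom (suc (p + q)) p       ≡⟨ cong (λ n → suc q * binom n p) (+-suc p q) ⟨
  suc q * binom (p + suc q) p         ≡⟨ cong (suc q *_) (binom-sym p (suc q)) ⟩
  suc q * binom (p + suc q) (suc q)   ≡⟨ cong (λ n → suc q * binom n (suc q)) (+-suc p q) ⟩
  suc q * binom (suc (p + q)) (suc q) ≡⟨ binom-absorb (p + q) q ⟩
  suc (p + q) * binom (p + q) q       ≡⟨ cong (suc (p + q) *_) (binom-sym p q) ⟨
  suc (p + q) * binom (p + q) p       ∎
  where open ≡-Reasoning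

binom-factorial : ∀ a b → binom (a + b) a * (a ! * b !) ≡ (a + b) !
binom-factorial zero    b = trans (+-identityʳ (b ! + 0)) (+-identityʳ (b !))
binom-factorial (suc a) b = begin
  binom (suc a + b) (suc a) * (suc a * a ! * b !)     ≡⟨ rearrange (binom (suc a + b) (suc a)) (suc a) (a !) (b !) ⟩
  suc a * binom (suc a + b) (suc a) * (a ! * b !)     ≡⟨ cong (_* (a ! * b !)) (binom-absorb (a + b) a) ⟩
  suc (a + b) * binom (a + b) a * (a ! * b !)         ≡⟨ *-assoc (suc (a + b)) (binom (a + b) a) (a ! * b !) ⟩
  suc (a + b) * (binom (a + b) a * (a ! * b !))       ≡⟨ cong (suc (a + b) *_) (binom-factorial a b) ⟩
  suc (a + b) * (a + b) !                             ∎
  where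
  open ≡-Reasoning
  rearrange : ∀ c s x y → c * (s * x * y) ≡ s * c * (x * y)
  rearrange = solve-∀

-- Both sides equal (2a+u+w)! / (a! a! u! w!).
binom-multinomial : ∀ a u w →
  binom (a + (u + w)) a * binom (a + (a + (u + w))) a * binom (u + w) u ≡
  binom ((a + u) + (a + w)) (a + u) * binom (a + u) a * binom (a + w) a
binom-multinomial a u w = *-cancelʳ-≡ _ _ F {{F≢0}} (trans left (trans same-total (sym right)))
  where
  open ≡-Reasoning
  F = a ! * a ! * u ! * w !
  F≢0 = m*n≢0 (a ! * a ! * u !) (w !) {{m*n≢0 (a ! * a !) (u !) {{m*n≢0 (a !) (a !) {{a !≢0}} {{a !≢0}}}} {{u !≢0}}}} {{w !≢0}}
  same-total : (a + (a + (u + w))) ! ≡ ((a + u) + (a + w)) !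
  same-total = cong _! (regroup a u w)
    where
    regroup : ∀ a u w → a + (a + (u + w)) ≡ (a + u) + (a + w)
    regroup = solve-∀
  left : binom (a + (u + w)) a * binom (a + (a + (u + w))) a * binom (u + w) u * F ≡ (a + (a + (u + w))) !
  left = begin
    c₁ * c₂ * c₃ * F                                        ≡⟨ rearrange c₁ c₂ c₃ (a !) (a !) (u !) (w !) ⟩
    c₂ * (a ! * (c₁ * (a ! * (c₃ * (u ! * w !)))))          ≡⟨ cong (λ x → c₂ * (a ! * (c₁ * (a ! * x)))) (binom-factorial u w) ⟩
    c₂ * (a ! * (c₁ * (a ! * (u + w) !)))                   ≡⟨ cong (λ x → c₂ * (a ! * x)) (binom-factorial a (u + w)) ⟩
    c₂ * (a ! * (a + (u + w)) !)                            ≡⟨ binom-factorial a (a + (u + w)) ⟩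
    (a + (a + (u + w))) !                                   ∎
    where
    c₁ = binom (a + (u + w)) a
    c₂ = binom (a + (a + (u + w))) a
    c₃ = binom (u + w) u
    rearrange : ∀ c₁ c₂ c₃ x y z t → c₁ * c₂ * c₃ * (x * y * z * t) ≡ c₂ * (x * (c₁ * (y * (c₃ * (z * t)))))
    rearrange = solve-∀
  right : binom ((a + u) + (a + w)) (a + u) * binom (a + u) a * binom (a + w) a * F ≡ ((a + u) + (a + w)) !
  right = begin
    d₁ * d₂ * d₃ * F                                        ≡⟨ rearrange d₁ d₂ d₃ (a !) (a !) (u !) (w !) ⟩
    d₁ * (d₂ * (a ! * u !) * (d₃ * (a ! * w !)))            ≡⟨ cong₂ (λ x y → d₁ * (x * y)) (binom-factorial a u) (binom-factorial a w) ⟩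
    d₁ * ((a + u) ! * (a + w) !)                            ≡⟨ binom-factorial (a + u) (a + w) ⟩
    ((a + u) + (a + w)) !                                   ∎
    where
    d₁ = binom ((a + u) + (a + w)) (a + u)
    d₂ = binom (a + u) a
    d₃ = binom (a + w) a
    rearrange : ∀ d₁ d₂ d₃ x y z t → d₁ * d₂ * d₃ * (x * y * z * t) ≡ d₁ * (d₂ * (x * z) * (d₃ * (y * t)))
    rearrange = solve-∀

vandermonde : ∀ p q r → sumTo (suc p) (λ i → binom p i * binom q (r + i)) ≡ binom (p + q) (r + p)
vandermonde zero    q r = +-identityʳ (binom q (r + 0))
vandermonde (suc p) q r = begin
  sumTo (suc (suc p)) f
    ≡⟨ sumTo-suc (suc p) f ⟩
  f 0 + sumTo (suc p) (λ i → f (suc i))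
    ≡⟨ cong (f 0 +_) (sumTo-cong (suc p) λ i _ → pascal i) ⟩
  f 0 + sumTo (suc p) (λ i → g (suc r) i + g r (suc i))
    ≡⟨ cong (f 0 +_) (sumTo-+ (suc p) (g (suc r)) (λ i → g r (suc i))) ⟩
  f 0 + (sumTo (suc p) (g (suc r)) + sumTo (suc p) (λ i → g r (suc i)))
    ≡⟨ rearrange (f 0) (sumTo (suc p) (g (suc r))) _ ⟩
  sumTo (suc p) (g (suc r)) + (f 0 + sumTo (suc p) (λ i → g r (suc i)))
    ≡⟨ cong (sumTo (suc p) (g (suc r)) +_) (sym (sumTo-suc (suc p) (g r))) ⟩
  sumTo (suc p) (g (suc r)) + sumTo (suc (suc p)) (g r)
    ≡⟨ cong (sumTo (suc p) (g (suc r)) +_) (trans (cong (sumTo (suc p) (g r) +_) last-vanishes) (+-identityʳ _)) ⟩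
  sumTo (suc p) (g (suc r)) + sumTo (suc p) (g r)
    ≡⟨ cong₂ _+_ (vandermonde p q (suc r)) (vandermonde p q r) ⟩
  binom (p + q) (suc (r + p)) + binom (p + q) (r + p)
    ≡⟨ +-comm (binom (p + q) (suc (r + p))) _ ⟩
  binom (suc p + q) (suc (r + p))
    ≡⟨ cong (binom (suc p + q)) (+-suc r p) ⟨
  binom (suc p + q) (r + suc p) ∎
  where
  open ≡-Reasoning
  f : ℕ → ℕ
  f i = binom (suc p) i * binom q (r + i)
  g : ℕ → ℕ → ℕ
  g s i = binom p i * binom q (s + i)
  pascal : ∀ i → f (suc i) ≡ g (suc r) i + g r (suc i)
  pascal i = trans (*-distribʳ-+ (binom q (r + suc i)) (binom p i) (binom p (suc i)))
                   (cong (λ n → binom p i * binom q n + g r (suc i)) (+-suc r i))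
  last-vanishes : g r (suc p) ≡ 0
  last-vanishes = cong (_* binom q (r + suc p)) (binom-> (n<1+n p))
  rearrange : ∀ a b c → a + (b + c) ≡ b + (a + c)
  rearrange = solve-∀

-- Weak compositions and sparse Boolean words

_∷ᴾ_ : {A : Set} → A → (List A → Set) → List A → Set
(x ∷ᴾ P) []       = ⊥
(x ∷ᴾ P) (y ∷ ys) = y ≡ x × P ys

module _ {A : Set} where

  Card-∷ᴾ : ∀ {P : List A → Set} {n} x → Card P n → Card (x ∷ᴾ P) n
  Card-∷ᴾ {P} x = Card-inverse (x ∷_) (drop 1) (λ _ p → refl , p) tail-P (λ _ _ → refl) cons-drop
    where
    tail-P : ∀ ys → (x ∷ᴾ P) ys → P (drop 1 ys)
    tail-P (_ ∷ _) (refl , p) = p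
    cons-drop : ∀ ys → (x ∷ᴾ P) ys → x ∷ drop 1 ys ≡ ys
    cons-drop (_ ∷ _) (refl , _) = refl

  ∷ᴾ⇔ : ∀ {P Q : List A → Set} x → ¬ P [] → (∀ y ys → P (y ∷ ys) → y ≡ x) → (∀ ys → Q ys ⇔ P (x ∷ ys)) →
        ∀ ys → (x ∷ᴾ Q) ys ⇔ P ys
  ∷ᴾ⇔ {P} {Q} x ¬P[] head tail ys = mk⇔ (assemble ys) (decompose ys)
    where
    assemble : ∀ ys → (x ∷ᴾ Q) ys → P ys
    assemble (_ ∷ ys) (refl , q) = to (tail ys) q
    decompose : ∀ ys → P ys → (x ∷ᴾ Q) ys
    decompose []       p = ¬P[] p
    decompose (y ∷ ys) p with head y ys p
    ... | refl = refl , from (tail ys) p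

Card-Bool∷ᴾ : ∀ {P Q R : List Bool → Set} {m n} → ¬ P [] →
  (∀ bs → Q bs ⇔ P (false ∷ bs)) → (∀ bs → R bs ⇔ P (true ∷ bs)) → Card Q m → Card R n → Card P (m + n)
Card-Bool∷ᴾ {P} {Q} {R} ¬P[] tail-false tail-true cardQ cardR =
  Card-resp-⇔ by-head (Card-⊎ disjoint (Card-∷ᴾ false cardQ) (Card-∷ᴾ true cardR))
  where
  disjoint : ∀ bs → (false ∷ᴾ Q) bs → (true ∷ᴾ R) bs → ⊥
  disjoint (_ ∷ _) (refl , _) (() , _)
  by-head : ∀ bs → ((false ∷ᴾ Q) bs ⊎ (true ∷ᴾ R) bs) ⇔ P bs
  by-head bs = mk⇔ (assemble bs) (decompose bs)
    where
    assemble : ∀ bs → (false ∷ᴾ Q) bs ⊎ (true ∷ᴾ R) bs → P bs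
    assemble (_ ∷ bs) (inj₁ (refl , q)) = to (tail-false bs) q
    assemble (_ ∷ bs) (inj₂ (refl , r)) = to (tail-true bs) r
    decompose : ∀ bs → P bs → (false ∷ᴾ Q) bs ⊎ (true ∷ᴾ R) bs
    decompose []           p = ⊥-elim (¬P[] p)
    decompose (false ∷ bs) p = inj₁ (refl , from (tail-false bs) p)
    decompose (true  ∷ bs) p = inj₂ (refl , from (tail-true bs) p)

WeakComposition : ℕ → ℕ → List ℕ → Set
WeakComposition n s v = length v ≡ n × sum v ≡ s

sucᴾ : (List ℕ → Set) → List ℕ → Set
sucᴾ P []           = ⊥
sucᴾ P (zero  ∷ ys) = ⊥
sucᴾ P (suc x ∷ ys) = P (x ∷ ys)

Card-sucᴾ : ∀ {P : List ℕ → Set} {n} → ¬ P [] → Card P n → Card (sucᴾ P) n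
Card-sucᴾ {P} ¬P[] = Card-inverse incHead decHead into back dec-inc inc-dec
  where
  incHead decHead : List ℕ → List ℕ
  incHead []       = []
  incHead (x ∷ ys) = suc x ∷ ys
  decHead []       = []
  decHead (x ∷ ys) = pred x ∷ ys
  into : ∀ ys → P ys → sucᴾ P (incHead ys)
  into []       p = ¬P[] p
  into (_ ∷ _)  p = p
  back : ∀ ys → sucᴾ P ys → P (decHead ys)
  back (suc _ ∷ _) p = p
  dec-inc : ∀ ys → P ys → decHead (incHead ys) ≡ ys
  dec-inc []      p = ⊥-elim (¬P[] p)
  dec-inc (_ ∷ _) _ = refl
  inc-dec : ∀ ys → sucᴾ P ys → incHead (decHead ys) ≡ ys
  inc-dec (suc _ ∷ _) _ = refl

card-WeakComposition : ∀ n s → Card (WeakComposition (suc n) s) (binom (n + s) n)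
card-WeakComposition zero s = Card-singleton (s ∷ []) (refl , +-identityʳ s) only
  where
  only : ∀ v → WeakComposition 1 s v → v ≡ s ∷ []
  only (x ∷ []) (_ , x+0≡s) = cong (_∷ []) (trans (sym (+-identityʳ x)) x+0≡s)
card-WeakComposition (suc n) zero =
  subst (Card _) (sym (trans (cong (binom (n + 0) n +_) (binom-> (s≤s (≤-reflexive (+-identityʳ n))))) (+-identityʳ _)))
    (Card-resp-⇔ (∷ᴾ⇔ 0 (λ ()) head-0 λ _ → mk⇔ (λ (len , s) → cong suc len , s) (λ (len , s) → suc-injective len , s))
                 (Card-∷ᴾ 0 (card-WeakComposition n 0)))
  where
  head-0 : ∀ y ys → WeakComposition (suc (suc n)) 0 (y ∷ ys) → y ≡ 0
  head-0 y ys (_ , y+s≡0) = m+n≡0⇒m≡0 y y+s≡0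
card-WeakComposition (suc n) (suc s) =
  subst (Card _) (cong (binom (n + suc s) n +_) (cong (λ m → binom m (suc n)) (sym (+-suc n s))))
    (Card-resp-⇔ by-head (Card-⊎ disjoint (Card-∷ᴾ 0 (card-WeakComposition n (suc s)))
                                          (Card-sucᴾ (λ ()) (card-WeakComposition (suc n) s))))
  where
  disjoint : ∀ v → (0 ∷ᴾ WeakComposition (suc n) (suc s)) v → sucᴾ (WeakComposition (suc (suc n)) s) v → ⊥
  disjoint (zero ∷ _) _ ()
  by-head : ∀ v → ((0 ∷ᴾ WeakComposition (suc n) (suc s)) v ⊎ sucᴾ (WeakComposition (suc (suc n)) s) v) ⇔
                  WeakComposition (suc (suc n)) (suc s) v
  by-head v = mk⇔ (assemble v) (decompose v)
    where
    assemble : ∀ v → (0 ∷ᴾ WeakComposition (suc n) (suc s)) v ⊎ sucᴾ (WeakComposition (suc (suc n)) s) v →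
               WeakComposition (suc (suc n)) (suc s) v
    assemble (_     ∷ v) (inj₁ (refl , len , sum≡)) = cong suc len , sum≡
    assemble (suc _ ∷ v) (inj₂ (len , sum≡))        = len , cong suc sum≡
    decompose : ∀ v → WeakComposition (suc (suc n)) (suc s) v →
                (0 ∷ᴾ WeakComposition (suc n) (suc s)) v ⊎ sucᴾ (WeakComposition (suc (suc n)) s) v
    decompose (zero  ∷ v) (len , sum≡) = inj₁ (refl , suc-injective len , sum≡)
    decompose (suc _ ∷ v) (len , sum≡) = inj₂ (len , suc-injective sum≡)

ones : List Bool → ℕ
ones []           = 0
ones (true  ∷ bs) = suc (ones bs)
ones (false ∷ bs) = ones bs

-- the word p ∷ bs ++ q ∷ [] has no two consecutive trues
SparseBetween : Bool → List Bool → Bool → Set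
SparseBetween p []       q = p ∧ q ≡ false
SparseBetween p (b ∷ bs) q = p ∧ b ≡ false × SparseBetween b bs q

SparseWord : Bool → Bool → ℕ → ℕ → List Bool → Set
SparseWord p q n j bs = length bs ≡ n × ones bs ≡ j × SparseBetween p bs q

sparseCount : Bool → Bool → ℕ → ℕ → ℕ
sparseCount p     q zero    zero    = if p ∧ q then 0 else 1
sparseCount p     q zero    (suc j) = 0
sparseCount true  q (suc n) j       = sparseCount false q n j
sparseCount false q (suc n) zero    = sparseCount false q n zero
sparseCount false q (suc n) (suc j) = sparseCount false q n (suc j) + sparseCount true q n j

SparseWord-false∷ : ∀ p q n j bs → SparseWord false q n j bs ⇔ SparseWord p q (suc n) j (false ∷ bs)
SparseWord-false∷ p q n j bs = mk⇔ (λ (len , ones≡ , sparse) → cong suc len , ones≡ , ∧-zeroʳ p , sparse)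
                                   (λ (len , ones≡ , _ , sparse) → suc-injective len , ones≡ , sparse)

SparseWord-true∷ : ∀ q n j bs → SparseWord true q n j bs ⇔ SparseWord false q (suc n) (suc j) (true ∷ bs)
SparseWord-true∷ q n j bs = mk⇔ (λ (len , ones≡ , sparse) → cong suc len , cong suc ones≡ , refl , sparse)
                                (λ (len , ones≡ , _ , sparse) → suc-injective len , suc-injective ones≡ , sparse)

card-SparseWord : ∀ p q n j → Card (SparseWord p q n j) (sparseCount p q n j)
card-SparseWord p q zero zero with p ∧ q in p∧q
... | true  = Card-∅ λ { [] (_ , _ , p∧q≡false) → true≢false (trans (sym p∧q) p∧q≡false) }
  where
  true≢false : true ≢ false
  true≢false ()
... | false = Card-singleton [] (refl , refl , p∧q) λ { [] _ → refl }
card-SparseWord p q zero (suc j) = Card-∅ λ { [] (_ , () , _) }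
card-SparseWord true q (suc n) j =
  Card-resp-⇔ (∷ᴾ⇔ false (λ ()) (λ _ _ (_ , _ , y≡false , _) → y≡false) (SparseWord-false∷ true q n j))
              (Card-∷ᴾ false (card-SparseWord false q n j))
card-SparseWord false q (suc n) zero =
  Card-resp-⇔ (∷ᴾ⇔ false (λ ()) no-ones (SparseWord-false∷ false q n zero))
              (Card-∷ᴾ false (card-SparseWord false q n zero))
  where
  no-ones : ∀ y ys → SparseWord false q (suc n) zero (y ∷ ys) → y ≡ false
  no-ones false _ _ = refl
card-SparseWord false q (suc n) (suc j) =
  Card-Bool∷ᴾ (λ ()) (SparseWord-false∷ false q n (suc j)) (SparseWord-true∷ q n j)
    (card-SparseWord false q n (suc j)) (card-SparseWord true q n j)

sparseCount-< : ∀ p q {n j} → n < j → sparseCount p q n j ≡ 0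
sparseCount-< p     q {zero}  {suc j} _   = refl
sparseCount-< true  q {suc n} {j}     n<j = sparseCount-< false q (≤-trans (n≤1+n (suc n)) n<j)
sparseCount-< false q {suc n} {suc j} n<j =
  cong₂ _+_ (sparseCount-< false q (≤-trans (n≤1+n (suc n)) n<j)) (sparseCount-< true q (s≤s⁻¹ n<j))

sparseCount-no-ones : ∀ q n → sparseCount false q n 0 ≡ 1
sparseCount-no-ones q zero    = refl
sparseCount-no-ones q (suc n) = sparseCount-no-ones q n

sparseCount-step : ∀ q x j → sparseCount false q (suc x + suc j) (suc j) ≡
                   sparseCount false q (x + suc j) (suc j) + sparseCount false q (x + j) j
sparseCount-step q x j = cong (λ m → sparseCount false q (x + suc j) (suc j) + sparseCount true q m j) (+-suc x j)

sparseCount-free : ∀ x j → sparseCount false false (x + j) j ≡ binom (suc x) j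
sparseCount-free x       zero    = sparseCount-no-ones false (x + 0)
sparseCount-free zero    (suc j) = cong₂ _+_ (sparseCount-< false false (n<1+n j)) (last j)
  where
  last : ∀ j → sparseCount true false j j ≡ binom 1 (suc j)
  last zero    = refl
  last (suc j) = sparseCount-< false false (n<1+n j)
sparseCount-free (suc x) (suc j) = begin
  sparseCount false false (suc x + suc j) (suc j)
    ≡⟨ sparseCount-step false x j ⟩
  sparseCount false false (x + suc j) (suc j) + sparseCount false false (x + j) j
    ≡⟨ cong₂ _+_ (sparseCount-free x (suc j)) (sparseCount-free x j) ⟩
  binom (suc x) (suc j) + binom (suc x) j
    ≡⟨ +-comm (binom (suc x) (suc j)) _ ⟩
  binom (suc (suc x)) (suc j) ∎
  where open ≡-Reasoning

sparseCount-ending : ∀ x j → sparseCount false true (x + j) j ≡ binom x j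
sparseCount-ending x       zero    = sparseCount-no-ones true (x + 0)
sparseCount-ending zero    (suc j) = cong₂ _+_ (sparseCount-< false true (n<1+n j)) (last j)
  where
  last : ∀ j → sparseCount true true j j ≡ 0
  last zero    = refl
  last (suc j) = sparseCount-< false true (n<1+n j)
sparseCount-ending (suc x) (suc j) = begin
  sparseCount false true (suc x + suc j) (suc j)
    ≡⟨ sparseCount-step true x j ⟩
  sparseCount false true (x + suc j) (suc j) + sparseCount false true (x + j) j
    ≡⟨ cong₂ _+_ (sparseCount-ending x (suc j)) (sparseCount-ending x j) ⟩
  binom x (suc j) + binom x j
    ≡⟨ +-comm (binom x (suc j)) _ ⟩
  binom (suc x) (suc j) ∎
  where open ≡-Reasoning

CyclicallySparse : List Bool → Set
CyclicallySparse []       = ⊤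
CyclicallySparse (b ∷ bs) = SparseBetween b bs b

CyclicWord : ℕ → ℕ → List Bool → Set
CyclicWord n j bs = length bs ≡ n × ones bs ≡ j × CyclicallySparse bs

cyclicCount : ℕ → ℕ → ℕ
cyclicCount n zero    = sparseCount false false n zero
cyclicCount n (suc j) = sparseCount false false n (suc j) + sparseCount true true n j

CyclicWord-false∷ : ∀ n j bs → SparseWord false false n j bs ⇔ CyclicWord (suc n) j (false ∷ bs)
CyclicWord-false∷ n j bs = mk⇔ (λ (len , ones≡ , sparse) → cong suc len , ones≡ , sparse)
                               (λ (len , ones≡ , sparse) → suc-injective len , ones≡ , sparse)

CyclicWord-true∷ : ∀ n j bs → SparseWord true true n j bs ⇔ CyclicWord (suc n) (suc j) (true ∷ bs)
CyclicWord-true∷ n j bs = mk⇔ (λ (len , ones≡ , sparse) → cong suc len , cong suc ones≡ , sparse)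
                              (λ (len , ones≡ , sparse) → suc-injective len , suc-injective ones≡ , sparse)

card-CyclicWord : ∀ n j → Card (CyclicWord (suc n) j) (cyclicCount n j)
card-CyclicWord n zero =
  Card-resp-⇔ (∷ᴾ⇔ false (λ ()) no-ones (CyclicWord-false∷ n zero)) (Card-∷ᴾ false (card-SparseWord false false n zero))
  where
  no-ones : ∀ y ys → CyclicWord (suc n) zero (y ∷ ys) → y ≡ false
  no-ones false _ _ = refl
card-CyclicWord n (suc j) =
  Card-Bool∷ᴾ (λ ()) (CyclicWord-false∷ n (suc j)) (CyclicWord-true∷ n j)
    (card-SparseWord false false n (suc j)) (card-SparseWord true true n j)

cyclicCount-closed : ∀ a b → cyclicCount (suc (a + b)) (suc a) ≡ binom (suc b) (suc a) + binom b a
cyclicCount-closed a b = cong₂ _+_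
  (trans (cong (λ n → sparseCount false false n (suc a)) (trans (cong suc (+-comm a b)) (sym (+-suc b a))))
         (sparseCount-free b (suc a)))
  (trans (cong (λ n → sparseCount false true n a) (+-comm a b)) (sparseCount-ending b a))

map-not-involutive : ∀ bs → map not (map not bs) ≡ bs
map-not-involutive bs = trans (sym (map-∘ bs)) (trans (map-cong not-involutive bs) (map-id bs))

card-CyclicWord-not : ∀ n j → Card (λ bs → CyclicWord (suc n) j (map not bs)) (cyclicCount n j)
card-CyclicWord-not n j =
  Card-inverse (map not) (map not)
    (λ bs w → subst (CyclicWord (suc n) j) (sym (map-not-involutive bs)) w) (λ _ w → w)
    (λ bs _ → map-not-involutive bs) (λ bs _ → map-not-involutive bs)
    (card-CyclicWord n j)

-- Compositions with a given shape

isLarge : ℕ → Bool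
isLarge (suc (suc _)) = true
isLarge _             = false

shape : List ℕ → List Bool
shape = map isLarge

-- A composition is determined by its shape and the excesses (part − 2) of its large parts.
fill : List Bool → List ℕ → List ℕ
fill []           v       = []
fill (false ∷ bs) v       = 1 ∷ fill bs v
fill (true  ∷ bs) []      = 2 ∷ fill bs []
fill (true  ∷ bs) (x ∷ v) = suc (suc x) ∷ fill bs v

excess : List ℕ → List ℕ
excess []                = []
excess (zero        ∷ c) = excess c
excess (suc zero    ∷ c) = excess c
excess (suc (suc x) ∷ c) = x ∷ excess c

shape-fill : ∀ bs v → shape (fill bs v) ≡ bs
shape-fill []           v       = refl
shape-fill (false ∷ bs) v       = cong (false ∷_) (shape-fill bs v)
shape-fill (true  ∷ bs) []      = cong (true ∷_) (shape-fill bs [])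
shape-fill (true  ∷ bs) (x ∷ v) = cong (true ∷_) (shape-fill bs v)

length-fill : ∀ bs v → length (fill bs v) ≡ length bs
length-fill bs v = trans (sym (length-map isLarge (fill bs v))) (cong length (shape-fill bs v))

fill-positive : ∀ bs v → All (1 ≤_) (fill bs v)
fill-positive []           v       = []
fill-positive (false ∷ bs) v       = s≤s z≤n ∷ fill-positive bs v
fill-positive (true  ∷ bs) []      = s≤s z≤n ∷ fill-positive bs []
fill-positive (true  ∷ bs) (x ∷ v) = s≤s z≤n ∷ fill-positive bs v

excess-fill : ∀ bs v → length v ≡ ones bs → excess (fill bs v) ≡ v
excess-fill []           []      _   = refl
excess-fill (false ∷ bs) v       len = excess-fill bs v len
excess-fill (true  ∷ bs) (x ∷ v) len = cong (x ∷_) (excess-fill bs v (suc-injective len))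

sum-fill : ∀ bs v → length v ≡ ones bs → sum (fill bs v) ≡ length bs + ones bs + sum v
sum-fill []           []      _   = refl
sum-fill (false ∷ bs) v       len = cong suc (sum-fill bs v len)
sum-fill (true  ∷ bs) (x ∷ v) len = begin
  suc (suc x) + sum (fill bs v)                ≡⟨ cong (suc (suc x) +_) (sum-fill bs v (suc-injective len)) ⟩
  suc (suc x) + (length bs + ones bs + sum v)  ≡⟨ rearrange x (length bs) (ones bs) (sum v) ⟩
  suc (length bs) + suc (ones bs) + (x + sum v) ∎
  where
  open ≡-Reasoning
  rearrange : ∀ x l o s → suc (suc x) + (l + o + s) ≡ suc l + suc o + (x + s)
  rearrange = solve-∀

fill-shape : ∀ c → All (1 ≤_) c → fill (shape c) (excess c) ≡ c
fill-shape []                []      = refl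
fill-shape (suc zero    ∷ c) (_ ∷ p) = cong (1 ∷_) (fill-shape c p)
fill-shape (suc (suc x) ∷ c) (_ ∷ p) = cong (suc (suc x) ∷_) (fill-shape c p)

length-excess : ∀ c → length (excess c) ≡ ones (shape c)
length-excess []                = refl
length-excess (zero        ∷ c) = length-excess c
length-excess (suc zero    ∷ c) = length-excess c
length-excess (suc (suc x) ∷ c) = cong suc (length-excess c)

card-shaped-composition : ∀ {W : List Bool → Set} {N S t e m n} →
  (∀ bs → W bs → length bs ≡ N × ones bs ≡ t) → N + t + e ≡ S →
  Card W m → Card (WeakComposition t e) n → Card (λ c → IsComposition S N c × W (shape c)) (m * n)
card-shaped-composition {W} {N} {S} {t} {e} W-size total cardW cardV =
  Card-image (uncurry fill) injective into onto (Card-× cardW cardV)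
  where
  open ≡-Reasoning
  excess-length : ∀ bs v → W bs → WeakComposition t e v → length v ≡ ones bs
  excess-length bs v wbs (len , _) = trans len (sym (proj₂ (W-size _ wbs)))
  injective : ∀ {x y} → W (proj₁ x) × WeakComposition t e (proj₂ x) → W (proj₁ y) × WeakComposition t e (proj₂ y) →
              uncurry fill x ≡ uncurry fill y → x ≡ y
  injective {bs , v} {bs′ , v′} (wbs , wv) (wbs′ , wv′) eq =
    cong₂ _,_ (trans (sym (shape-fill bs v)) (trans (cong shape eq) (shape-fill bs′ v′)))
              (trans (sym (excess-fill bs v (excess-length bs v wbs wv)))
                     (trans (cong excess eq) (excess-fill bs′ v′ (excess-length bs′ v′ wbs′ wv′))))
  into : ∀ x → W (proj₁ x) × WeakComposition t e (proj₂ x) → IsComposition S N (uncurry fill x) × W (shape (uncurry fill x))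
  into (bs , v) (wbs , wv@(_ , sum-v)) =
    (fill-positive bs v ,
     trans (sum-fill bs v (excess-length bs v wbs wv))
           (trans (cong₂ (λ l o → l + o + sum v) len ones≡) (trans (cong (N + t +_) sum-v) total)) ,
     trans (length-fill bs v) len) ,
    subst W (sym (shape-fill bs v)) wbs
    where
    len = proj₁ (W-size bs wbs)
    ones≡ = proj₂ (W-size bs wbs)
  onto : ∀ c → IsComposition S N c × W (shape c) →
         Σ (List Bool × List ℕ) λ x → (W (proj₁ x) × WeakComposition t e (proj₂ x)) × c ≡ uncurry fill x
  onto c ((pos , sum-c , len-c) , wc) = (shape c , excess c) , (wc , len-v , sum-v) , sym (fill-shape c pos)
    where
    len-v : length (excess c) ≡ t
    len-v = trans (length-excess c) (proj₂ (W-size (shape c) wc))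
    sum-v : sum (excess c) ≡ e
    sum-v = +-cancelˡ-≡ (N + t) _ _ (begin
      N + t + sum (excess c)                                   ≡⟨ cong₂ (λ l o → l + o + sum (excess c)) (proj₁ (W-size _ wc)) (proj₂ (W-size _ wc)) ⟨
      length (shape c) + ones (shape c) + sum (excess c)       ≡⟨ sum-fill (shape c) (excess c) (length-excess c) ⟨
      sum (fill (shape c) (excess c))                          ≡⟨ cong sum (fill-shape c pos) ⟩
      sum c                                                    ≡⟨ trans sum-c (sym total) ⟩
      N + t + e                                                ∎)

-- Rotations and the cycle lemma

RotationInvariant : {A : Set} → (List A → Set) → Set
RotationInvariant P = ∀ x xs → P (x ∷ xs) → P (xs ++ x ∷ [])

rotate : {A : Set} → ℕ → List A → List A
rotate zero    xs       = xs
rotate (suc d) []       = []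
rotate (suc d) (x ∷ xs) = rotate d (xs ++ x ∷ [])

module _ {A : Set} where

  rotate-[] : ∀ d → rotate d [] ≡ ([] {A = A})
  rotate-[] zero    = refl
  rotate-[] (suc d) = refl

  rotate-++ : ∀ (xs ys : List A) → rotate (length xs) (xs ++ ys) ≡ ys ++ xs
  rotate-++ []       ys = sym (++-identityʳ ys)
  rotate-++ (x ∷ xs) ys = begin
    rotate (length xs) ((xs ++ ys) ++ x ∷ [])  ≡⟨ cong (rotate (length xs)) (++-assoc xs ys (x ∷ [])) ⟩
    rotate (length xs) (xs ++ (ys ++ x ∷ []))  ≡⟨ rotate-++ xs (ys ++ x ∷ []) ⟩
    (ys ++ x ∷ []) ++ xs                       ≡⟨ ++-assoc ys (x ∷ []) xs ⟩
    ys ++ x ∷ xs                               ∎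
    where open ≡-Reasoning

  rotate-length : ∀ (xs : List A) → rotate (length xs) xs ≡ xs
  rotate-length xs = trans (cong (rotate (length xs)) (sym (++-identityʳ xs))) (rotate-++ xs [])

  rotate-rotate : ∀ a b (xs : List A) → rotate a (rotate b xs) ≡ rotate (b + a) xs
  rotate-rotate a zero    xs       = refl
  rotate-rotate a (suc b) []       = rotate-[] a
  rotate-rotate a (suc b) (x ∷ xs) = rotate-rotate a b (xs ++ x ∷ [])

  rotate-back : ∀ {n} i (xs : List A) → length xs ≡ n → i ≤ n → rotate (n ∸ i) (rotate i xs) ≡ xs
  rotate-back {n} i xs refl i≤n =
    trans (rotate-rotate (n ∸ i) i xs) (trans (cong (λ d → rotate d xs) (m+[n∸m]≡n i≤n)) (rotate-length xs))

  rotate-preserves : {P : List A → Set} → RotationInvariant P → ∀ d xs → P xs → P (rotate d xs)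
  rotate-preserves         step zero    xs       p = p
  rotate-preserves         step (suc d) []       p = p
  rotate-preserves {P = P} step (suc d) (x ∷ xs) p = rotate-preserves {P = P} step d (xs ++ x ∷ []) (step x xs p)

  take-length-++ : ∀ (xs ys : List A) → take (length xs) (xs ++ ys) ≡ xs
  take-length-++ []       ys = refl
  take-length-++ (x ∷ xs) ys = cong (x ∷_) (take-length-++ xs ys)

  take-++ˡ : ∀ {n} (xs ys : List A) → n ≤ length xs → take n (xs ++ ys) ≡ take n xs
  take-++ˡ {zero}  xs       ys _   = refl
  take-++ˡ {suc n} (x ∷ xs) ys n≤ = cong (x ∷_) (take-++ˡ xs ys (s≤s⁻¹ n≤))

  take-length-+-++ : ∀ (xs ys : List A) u → take (length xs + u) (xs ++ ys) ≡ xs ++ take u ys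
  take-length-+-++ []       ys u = refl
  take-length-+-++ (x ∷ xs) ys u = cong (x ∷_) (take-length-+-++ xs ys u)

  drop-length-++ : ∀ (xs ys : List A) → drop (length xs) (xs ++ ys) ≡ ys
  drop-length-++ []       ys = refl
  drop-length-++ (x ∷ xs) ys = drop-length-++ xs ys

  length-take-≤ : ∀ {n} (xs : List A) → n ≤ length xs → length (take n xs) ≡ n
  length-take-≤ {n} xs n≤ = trans (length-take n xs) (m≤n⇒m⊓n≡m n≤)

WeaklyDominating : List ℕ → Set
WeaklyDominating s = ∀ {t} → t < length s → 1 ≤ t → 2 * t ≤ sum (take t s)

weaklyDominating? : ∀ s → Dec (WeaklyDominating s)
weaklyDominating? s = allUpTo? (λ t → 1 ≤? t →-dec 2 * t ≤? sum (take t s)) (length s)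

weaklyDominating-++ : ∀ xs ys → 1 ≤ length xs → 1 ≤ length ys → WeaklyDominating (xs ++ ys) → 2 * length xs ≤ sum xs
weaklyDominating-++ xs ys 1≤xs 1≤ys wd =
  subst (λ p → 2 * length xs ≤ sum p) (take-length-++ xs ys)
        (wd (subst (length xs <_) (sym (length-++ xs)) (m<m+n (length xs) 1≤ys)) 1≤xs)

weaklyDominating-swap : ∀ xs ys → 1 ≤ length xs → 1 ≤ length ys →
  WeaklyDominating (xs ++ ys) → WeaklyDominating (ys ++ xs) → 2 * length (xs ++ ys) ≤ sum (xs ++ ys)
weaklyDominating-swap xs ys 1≤xs 1≤ys wd wd′ = begin
  2 * length (xs ++ ys)          ≡⟨ cong (2 *_) (length-++ xs) ⟩
  2 * (length xs + length ys)    ≡⟨ *-distribˡ-+ 2 (length xs) (length ys) ⟩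
  2 * length xs + 2 * length ys  ≤⟨ +-mono-≤ (weaklyDominating-++ xs ys 1≤xs 1≤ys wd) (weaklyDominating-++ ys xs 1≤ys 1≤xs wd′) ⟩
  sum xs + sum ys                ≡⟨ sum-++ xs ys ⟨
  sum (xs ++ ys)                 ∎
  where open ≤-Reasoning

first-minimum : (f : ℕ → ℕ) → ∀ n →
  ∃ λ m → m ≤ n × (∀ t → t ≤ n → f m ≤ f t) × (∀ t → t < m → f m < f t)
first-minimum f zero = 0 , z≤n , (λ { _ z≤n → ≤-refl }) , (λ _ ())
first-minimum f (suc n) with first-minimum f n
... | m , m≤n , minimal , first with f (suc n) <? f m
...   | yes smaller = suc n , ≤-refl , minimal′ , λ t t<1+n → <-≤-trans smaller (minimal t (s≤s⁻¹ t<1+n))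
  where
  minimal′ : ∀ t → t ≤ suc n → f (suc n) ≤ f t
  minimal′ t t≤1+n with t ≤? n
  ... | yes t≤n = <⇒≤ (<-≤-trans smaller (minimal t t≤n))
  ... | no  t≰n = ≤-reflexive (cong f (≤-antisym (≰⇒> t≰n) t≤1+n))
...   | no ¬smaller = m , m≤n⇒m≤1+n m≤n , minimal′ , first
  where
  minimal′ : ∀ t → t ≤ suc n → f m ≤ f t
  minimal′ t t≤1+n with t ≤? n
  ... | yes t≤n = minimal t t≤n
  ... | no  t≰n = subst (λ t → f m ≤ f t) (≤-antisym (≰⇒> t≰n) t≤1+n) (≮⇒≥ ¬smaller)

-- Cycle lemma: a list of N parts with sum 2N - 1 has a weakly dominating rotation.  It is obtained by
-- cutting after the first minimum of the potential sum (prefix) + 2 · (number of remaining parts).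
module _ (s : List ℕ) {N} (length-s : length s ≡ suc N) (sum-s : suc (sum s) ≡ 2 * suc N) where

  private
    potential : ℕ → ℕ
    potential m = sum (take m s) + 2 * length (drop m s)

    potential-split : ∀ xs ys → s ≡ xs ++ ys → potential (length xs) ≡ sum xs + 2 * length ys
    potential-split xs ys refl = cong₂ (λ p q → sum p + 2 * length q) (take-length-++ xs ys) (drop-length-++ xs ys)

  module _ (xs ys : List ℕ) (s≡xs++ys : s ≡ xs ++ ys)
           (minimal : ∀ t → t ≤ suc N → potential (length xs) ≤ potential t)
           (first : ∀ t → t < length xs → potential (length xs) < potential t) where

    private
      potential-cut : potential (length xs) ≡ sum xs + 2 * length ys
      potential-cut = potential-split xs ys s≡xs++ys

    cut-nonempty : 1 ≤ length xs
    cut-nonempty = nonzero (length xs) (minimal (suc N) ≤-refl)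
      where
      potential-whole : potential (suc N) ≡ sum s + 2 * 0
      potential-whole = trans (cong potential (sym length-s)) (potential-split s [] (sym (++-identityʳ s)))
      nonzero : ∀ m → potential m ≤ potential (suc N) → 1 ≤ m
      nonzero zero    p = ⊥-elim (n≮n (sum s) (subst₂ _≤_ (trans (cong (2 *_) length-s) (sym sum-s))
                                                     (trans potential-whole (trans (cong (sum s +_) (*-zeroʳ 2)) (+-identityʳ _))) p))
      nonzero (suc _) _ = s≤s z≤n

    rotation-inside : ∀ {t} → t ≤ length ys → 2 * t ≤ sum (take t (ys ++ xs))
    rotation-inside {t} t≤ys = subst (λ p → 2 * t ≤ sum p) (sym take-t) (cancel (sum xs) t (length ys₂) (sum ys₁) compare)
      where
      ys₁ = take t ys
      ys₂ = drop t ys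
      length-ys₁ : length ys₁ ≡ t
      length-ys₁ = length-take-≤ ys t≤ys
      ys≡ : ys ≡ ys₁ ++ ys₂
      ys≡ = sym (take++drop≡id t ys)
      take-t : take t (ys ++ xs) ≡ ys₁
      take-t = trans (cong₂ take (sym length-ys₁) (trans (cong (_++ xs) ys≡) (++-assoc ys₁ ys₂ xs)))
                     (take-length-++ ys₁ (ys₂ ++ xs))
      s≡ : s ≡ (xs ++ ys₁) ++ ys₂
      s≡ = trans s≡xs++ys (trans (cong (xs ++_) ys≡) (sym (++-assoc xs ys₁ ys₂)))
      bound : length (xs ++ ys₁) ≤ suc N
      bound = subst (length (xs ++ ys₁) ≤_) (trans (cong length (sym s≡)) length-s) (length-++-≤ˡ (xs ++ ys₁))
      compare : sum xs + 2 * (t + length ys₂) ≤ sum xs + sum ys₁ + 2 * length ys₂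
      compare = subst₂ _≤_
        (trans potential-cut (cong (λ l → sum xs + 2 * l) (trans (cong length ys≡) (trans (length-++ ys₁) (cong (_+ length ys₂) length-ys₁)))))
        (trans (potential-split (xs ++ ys₁) ys₂ s≡) (cong (_+ 2 * length ys₂) (sum-++ xs ys₁)))
        (minimal (length (xs ++ ys₁)) bound)
      cancel : ∀ X t r Y → X + 2 * (t + r) ≤ X + Y + 2 * r → 2 * t ≤ Y
      cancel X t r Y h = +-cancelʳ-≤ (X + 2 * r) (2 * t) Y (subst₂ _≤_ (e₁ X t r) (e₂ X Y r) h)
        where
        e₁ : ∀ X t r → X + 2 * (t + r) ≡ 2 * t + (X + 2 * r)
        e₁ = solve-∀
        e₂ : ∀ X Y r → X + Y + 2 * r ≡ Y + (X + 2 * r)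
        e₂ = solve-∀

    -- Here the strictness of the first minimum is needed.
    rotation-wrap : ∀ {t} → length ys < t → t < length (ys ++ xs) → 2 * t ≤ sum (take t (ys ++ xs))
    rotation-wrap {t} ys<t t<len = subst (λ p → 2 * t ≤ sum p) (sym take-t) (subst (_≤ sum (ys ++ xs₁)) (cong (2 *_) (sym t≡)) goal)
      where
      u = t ∸ length ys
      t≡ : t ≡ length ys + u
      t≡ = sym (m+[n∸m]≡n (<⇒≤ ys<t))
      u<m : u < length xs
      u<m = +-cancelˡ-< (length ys) u (length xs) (subst₂ _<_ t≡ (length-++ ys) t<len)
      xs₁ = take u xs
      xs₂ = drop u xs
      length-xs₁ : length xs₁ ≡ u
      length-xs₁ = length-take-≤ xs (<⇒≤ u<m)
      xs≡ : xs ≡ xs₁ ++ xs₂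
      xs≡ = sym (take++drop≡id u xs)
      take-t : take t (ys ++ xs) ≡ ys ++ xs₁
      take-t = trans (cong (λ t → take t (ys ++ xs)) t≡) (take-length-+-++ ys xs u)
      s≡ : s ≡ xs₁ ++ (xs₂ ++ ys)
      s≡ = trans s≡xs++ys (trans (cong (_++ ys) xs≡) (++-assoc xs₁ xs₂ ys))
      compare : sum xs₁ + sum xs₂ + 2 * length ys < sum xs₁ + 2 * (length xs₂ + length ys)
      compare = subst₂ _<_
        (trans potential-cut (cong (λ σ → σ + 2 * length ys) (trans (cong sum xs≡) (sum-++ xs₁ xs₂))))
        (trans (cong potential (sym length-xs₁)) (trans (potential-split xs₁ (xs₂ ++ ys) s≡) (cong (λ l → sum xs₁ + 2 * l) (length-++ xs₂))))
        (first u u<m)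
      total : suc (sum xs₁ + (sum xs₂ + sum ys)) ≡ 2 * (u + (length xs₂ + length ys))
      total = trans (cong suc (sym sum-split)) (trans sum-s (cong (2 *_) (trans (sym length-s) length-split)))
        where
        sum-split : sum s ≡ sum xs₁ + (sum xs₂ + sum ys)
        sum-split = trans (cong sum s≡) (trans (sum-++ xs₁ (xs₂ ++ ys)) (cong (sum xs₁ +_) (sum-++ xs₂ ys)))
        length-split : length s ≡ u + (length xs₂ + length ys)
        length-split = trans (cong length s≡) (trans (length-++ xs₁) (cong₂ _+_ length-xs₁ (length-++ xs₂)))
      goal : 2 * (length ys + u) ≤ sum (ys ++ xs₁)
      goal = subst (2 * (length ys + u) ≤_) (sym (sum-++ ys xs₁))
               (wrap (sum xs₁) (sum xs₂) (sum ys) u (length xs₂) (length ys) compare total)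
        where
        wrap : ∀ X Y Z u p r → X + Y + 2 * r < X + 2 * (p + r) → suc (X + (Y + Z)) ≡ 2 * (u + (p + r)) →
               2 * (r + u) ≤ Z + X
        wrap X Y Z u p r h tot = +-cancelʳ-≤ (2 * p + 2 * r) (2 * (r + u)) (Z + X)
          (subst₂ _≤_ (trans (e₁ X Y Z r) (trans (cong (_+ 2 * r) tot) (e₂ u p r))) (e₃ X Z p r) (+-monoˡ-≤ Z h))
          where
          e₁ : ∀ X Y Z r → suc (X + Y + 2 * r) + Z ≡ suc (X + (Y + Z)) + 2 * r
          e₁ = solve-∀
          e₂ : ∀ u p r → 2 * (u + (p + r)) + 2 * r ≡ 2 * (r + u) + (2 * p + 2 * r)
          e₂ = solve-∀
          e₃ : ∀ X Z p r → X + 2 * (p + r) + Z ≡ Z + X + (2 * p + 2 * r)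
          e₃ = solve-∀

  weaklyDominating-rotation : ∃₂ λ xs ys → s ≡ xs ++ ys × 1 ≤ length xs × WeaklyDominating (ys ++ xs)
  weaklyDominating-rotation with first-minimum potential (suc N)
  ... | m , m≤1+N , minimal , first =
    xs , ys , s≡xs++ys , cut-nonempty xs ys s≡xs++ys minimal′ first′ , weaklyDominating
    where
    xs = take m s
    ys = drop m s
    s≡xs++ys : s ≡ xs ++ ys
    s≡xs++ys = sym (take++drop≡id m s)
    length-xs : length xs ≡ m
    length-xs = length-take-≤ s (subst (m ≤_) (sym length-s) m≤1+N)
    minimal′ : ∀ t → t ≤ suc N → potential (length xs) ≤ potential t
    minimal′ t t≤ = subst (λ m → potential m ≤ potential t) (sym length-xs) (minimal t t≤)
    first′ : ∀ t → t < length xs → potential (length xs) < potential t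
    first′ t t< = subst (λ m → potential m < potential t) (sym length-xs) (first t (subst (t <_) length-xs t<))
    weaklyDominating : WeaklyDominating (ys ++ xs)
    weaklyDominating {t} t<len _ with t ≤? length ys
    ... | yes t≤ys = rotation-inside xs ys s≡xs++ys minimal′ first′ t≤ys
    ... | no  t≰ys = rotation-wrap xs ys s≡xs++ys minimal′ first′ (≰⇒> t≰ys) t<len

weaklyDominating-rotate-unique : ∀ w {N d} → length w ≡ suc N → suc (sum w) ≡ 2 * suc N → 1 ≤ d → d ≤ N →
  WeaklyDominating w → ¬ WeaklyDominating (rotate d w)
weaklyDominating-rotate-unique w {N} {d} length-w sum-w 1≤d d≤N wd wd′ =
  n≮n (sum w) (subst₂ _≤_ (trans (cong (2 *_) (trans (cong length (sym w≡)) length-w)) (sym sum-w)) (cong sum (sym w≡))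
    (weaklyDominating-swap xs ys (subst (1 ≤_) (sym length-xs) 1≤d) 1≤ys (subst WeaklyDominating w≡ wd)
      (subst WeaklyDominating rotated wd′)))
  where
  xs = take d w
  ys = drop d w
  w≡ : w ≡ xs ++ ys
  w≡ = sym (take++drop≡id d w)
  length-xs : length xs ≡ d
  length-xs = length-take-≤ w (subst (d ≤_) (sym length-w) (m≤n⇒m≤1+n d≤N))
  1≤ys : 1 ≤ length ys
  1≤ys = subst (1 ≤_) (sym (trans (length-drop d w) (cong (_∸ d) length-w))) (m<n⇒0<n∸m (s≤s d≤N))
  rotated : rotate d w ≡ ys ++ xs
  rotated = trans (cong (rotate d) w≡) (trans (cong (λ n → rotate n (xs ++ ys)) (sym length-xs)) (rotate-++ xs ys))

module _ {P : List ℕ → Set} {N : ℕ}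
         (P-rotate : RotationInvariant P)
         (P-size : ∀ s → P s → length s ≡ suc N × suc (sum s) ≡ 2 * suc N) where

  Seed : List ℕ × ℕ → Set
  Seed (w , i) = (P w × WeaklyDominating w) × i < suc N

  seed-rotate : ∀ x → Seed x → P (rotate (proj₂ x) (proj₁ x))
  seed-rotate (w , i) ((pw , _) , _) = rotate-preserves {P = P} P-rotate i w pw

  seed-onto : ∀ s → P s → ∃ λ x → Seed x × s ≡ rotate (proj₂ x) (proj₁ x)
  seed-onto s ps with weaklyDominating-rotation s (proj₁ (P-size s ps)) (proj₂ (P-size s ps))
  ... | xs , ys , refl , 1≤xs , wd = (ys ++ xs , length ys) , ((P-ys++xs , wd) , ys<) , sym (rotate-++ ys xs)
    where
    P-ys++xs : P (ys ++ xs)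
    P-ys++xs = subst P (rotate-++ xs ys) (rotate-preserves {P = P} P-rotate (length xs) (xs ++ ys) ps)
    ys< : length ys < suc N
    ys< = subst (length ys <_) (trans (sym (length-++ xs)) (proj₁ (P-size _ ps))) (+-monoˡ-≤ (length ys) 1≤xs)

  seed-injective-≤ : ∀ {w i w′ i′} → i ≤ i′ → Seed (w , i) → Seed (w′ , i′) →
                     rotate i w ≡ rotate i′ w′ → (w , i) ≡ (w′ , i′)
  seed-injective-≤ {w} {i} {w′} {i′} i≤i′ ((pw , wd) , i<) ((pw′ , wd′) , i′<) eq with m≤n⇒m<n∨m≡n i≤i′
  ... | inj₂ refl = cong (_, i) (begin
    w                                ≡⟨ rotate-back i w (proj₁ (P-size w pw)) (<⇒≤ i<) ⟨
    rotate (suc N ∸ i) (rotate i w)  ≡⟨ cong (rotate (suc N ∸ i)) eq ⟩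
    rotate (suc N ∸ i) (rotate i w′) ≡⟨ rotate-back i w′ (proj₁ (P-size w′ pw′)) (<⇒≤ i′<) ⟩
    w′                               ∎)
    where open ≡-Reasoning
  ... | inj₁ i<i′ = ⊥-elim (weaklyDominating-rotate-unique w (proj₁ (P-size w pw)) (proj₂ (P-size w pw)) 1≤d d≤N wd
                             (subst WeaklyDominating w′≡ wd′))
    where
    d = i + (suc N ∸ i′)
    w′≡ : w′ ≡ rotate d w
    w′≡ = trans (sym (rotate-back i′ w′ (proj₁ (P-size w′ pw′)) (<⇒≤ i′<)))
                (trans (cong (rotate (suc N ∸ i′)) (sym eq)) (rotate-rotate (suc N ∸ i′) i w))
    1≤d : 1 ≤ d
    1≤d = ≤-trans (m<n⇒0<n∸m i′<) (m≤n+m (suc N ∸ i′) i)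
    d≤N : d ≤ N
    d≤N = s≤s⁻¹ (subst (d <_) (m+[n∸m]≡n (<⇒≤ i′<)) (+-monoˡ-< (suc N ∸ i′) i<i′))

  seed-injective : ∀ {x y} → Seed x → Seed y → rotate (proj₂ x) (proj₁ x) ≡ rotate (proj₂ y) (proj₁ y) → x ≡ y
  seed-injective {_ , i} {_ , i′} sx sy eq with ≤-total i i′
  ... | inj₁ i≤i′ = seed-injective-≤ i≤i′ sx sy eq
  ... | inj₂ i′≤i = sym (seed-injective-≤ i′≤i sy sx (sym eq))

  card-rotations : ∀ {m} → Card (λ s → P s × WeaklyDominating s) m → Card P (m * suc N)
  card-rotations card =
    Card-image (λ (w , i) → rotate i w) seed-injective seed-rotate seed-onto (Card-× card (Card-< (suc N)))

  private
    quotient : ∀ {c} → Card P c → ∃ λ m → Card (λ s → P s × WeaklyDominating s) m × m * suc N ≡ c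
    quotient card with Card-∩ weaklyDominating? card
    ... | m , card-WD = m , card-WD , Card-unique (card-rotations card-WD) card

  card-weaklyDominating : ∀ {c} → Card P c → Card (λ s → P s × WeaklyDominating s) (c / suc N)
  card-weaklyDominating card with quotient card
  ... | m , card-WD , refl = subst (Card _) (sym (m*n/n≡m m (suc N))) card-WD

  quotient-exact : ∀ {c} → Card P c → c / suc N * suc N ≡ c
  quotient-exact card with quotient card
  ... | m , _ , refl = cong (_* suc N) (m*n/n≡m m (suc N))

-- Cyclic compositions

ones-++ : ∀ bs cs → ones (bs ++ cs) ≡ ones bs + ones cs
ones-++ []           cs = refl
ones-++ (true  ∷ bs) cs = cong suc (ones-++ bs cs)
ones-++ (false ∷ bs) cs = ones-++ bs cs

ones-not : ∀ bs → ones (map not bs) + ones bs ≡ length bs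
ones-not []           = refl
ones-not (true  ∷ bs) = trans (+-suc (ones (map not bs)) (ones bs)) (cong suc (ones-not bs))
ones-not (false ∷ bs) = cong suc (ones-not bs)

SparseBetween-++ : ∀ p bs b q → SparseBetween p (bs ++ b ∷ []) q ⇔ (SparseBetween p bs b × b ∧ q ≡ false)
SparseBetween-++ p []       b q = mk⇔ id id
SparseBetween-++ p (c ∷ bs) b q = mk⇔
  (λ (p∧c , rest) → let (sparse , b∧q) = to (SparseBetween-++ c bs b q) rest in (p∧c , sparse) , b∧q)
  (λ ((p∧c , sparse) , b∧q) → p∧c , from (SparseBetween-++ c bs b q) (sparse , b∧q))

CyclicWord-rotate : ∀ n j → RotationInvariant (CyclicWord n j)
CyclicWord-rotate n j b bs (len , ones≡ , sparse) =
  trans (length-++ bs) (trans (+-comm (length bs) 1) len) ,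
  trans (ones-++ bs (b ∷ [])) (trans (+-comm (ones bs) _) (trans (sym (ones-++ (b ∷ []) bs)) ones≡)) ,
  cyclicallySparse-rotate bs sparse
  where
  cyclicallySparse-rotate : ∀ bs → CyclicallySparse (b ∷ bs) → CyclicallySparse (bs ++ b ∷ [])
  cyclicallySparse-rotate []       sparse           = sparse
  cyclicallySparse-rotate (c ∷ bs) (b∧c , sparse) = from (SparseBetween-++ c bs b c) (sparse , b∧c)

map-rotate : ∀ {A B : Set} {W : List B → Set} (f : A → B) → RotationInvariant W → RotationInvariant (W ∘ map f)
map-rotate {W = W} f W-rotate x xs w = subst W (sym (map-++ f xs (x ∷ []))) (W-rotate (f x) (map f xs) w)

CyclicWord-not-rotate : ∀ n j → RotationInvariant (CyclicWord n j ∘ map not)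
CyclicWord-not-rotate n j = map-rotate {W = CyclicWord n j} not (CyclicWord-rotate n j)

IsComposition-rotate : ∀ S N → RotationInvariant (IsComposition S N)
IsComposition-rotate S N x xs (x≥1 ∷ pos , sum≡ , len) =
  All.++⁺ pos (x≥1 ∷ []) ,
  trans (sum-++ xs (x ∷ [])) (trans (+-comm (sum xs) (x + 0)) (trans (cong (_+ sum xs) (+-identityʳ x)) sum≡)) ,
  trans (length-++ xs) (trans (+-comm (length xs) 1) len)

Patterned : ℕ → (List Bool → Set) → List ℕ → Set
Patterned k W c = IsComposition (2 * k + 1) (suc k) c × W (shape c)

Patterned-rotate : ∀ k {W} → RotationInvariant W → RotationInvariant (Patterned k W)
Patterned-rotate k {W} W-rotate x xs (comp , w) =
  IsComposition-rotate _ _ x xs comp , map-rotate {W = W} isLarge W-rotate x xs w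

Patterned-size : ∀ k {W} c → Patterned k W c → length c ≡ suc k × suc (sum c) ≡ 2 * suc k
Patterned-size k c ((_ , sum≡ , len) , _) = len , trans (cong suc sum≡) (2k+2 k)
  where
  2k+2 : ∀ k → suc (2 * k + 1) ≡ 2 * suc k
  2k+2 = solve-∀

card-Patterned-large : ∀ a b → Card (Patterned (suc (a + b)) (CyclicWord (suc (suc (a + b))) (suc a)))
                                    (cyclicCount (suc (a + b)) (suc a) * binom (a + b) a)
card-Patterned-large a b =
  card-shaped-composition (λ _ (len , ones≡ , _) → len , ones≡) (total a b)
    (card-CyclicWord (suc (a + b)) (suc a)) (card-WeakComposition a b)
  where
  total : ∀ a b → suc (suc (a + b)) + suc a + b ≡ 2 * suc (a + b) + 1
  total = solve-∀

card-Patterned-one : ∀ a b → Card (Patterned (suc (a + b)) (CyclicWord (suc (suc (a + b))) (suc a) ∘ map not))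
                                  (cyclicCount (suc (a + b)) (suc a) * binom (a + b) a)
card-Patterned-one a b =
  subst (Card _) (cong (cyclicCount (suc (a + b)) (suc a) *_) (binom-swap b a))
    (card-shaped-composition size (total a b)
      (card-CyclicWord-not (suc (a + b)) (suc a)) (card-WeakComposition b a))
  where
  total : ∀ a b → suc (suc (a + b)) + suc b + a ≡ 2 * suc (a + b) + 1
  total = solve-∀
  binom-swap : ∀ b a → binom (b + a) b ≡ binom (a + b) a
  binom-swap b a = trans (binom-sym b a) (cong (λ n → binom n a) (+-comm b a))
  size : ∀ bs → CyclicWord (suc (suc (a + b))) (suc a) (map not bs) → length bs ≡ suc (suc (a + b)) × ones bs ≡ suc b
  size bs (len , ones≡ , _) = length≡ , +-cancelˡ-≡ (suc a) _ _ (begin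
      suc a + ones bs                  ≡⟨ cong (_+ ones bs) ones≡ ⟨
      ones (map not bs) + ones bs      ≡⟨ ones-not bs ⟩
      length bs                        ≡⟨ length≡ ⟩
      suc (suc (a + b))                ≡⟨ cong suc (+-suc a b) ⟨
      suc a + suc b                    ∎)
    where
    open ≡-Reasoning
    length≡ = trans (sym (length-map not bs)) len

-- cyclicCount k j · binom (k - 1) (j - 1) counts the cyclic compositions (card-Patterned-large); by the
-- cycle lemma k + 1 divides it, and the quotient counts the weakly dominating ones.
γᴺ : ℕ → ℕ → ℕ
γᴺ k j = cyclicCount k j * binom (k ∸ 1) (j ∸ 1) / suc k

card-Patterned-weaklyDominating : ∀ k {W c} → RotationInvariant W → Card (Patterned k W) c →
                                  Card (λ s → Patterned k W s × WeaklyDominating s) (c / suc k)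
card-Patterned-weaklyDominating k {W} W-rotate = card-weaklyDominating (Patterned-rotate k {W} W-rotate) (Patterned-size k {W})

γᴺ-spec : ∀ a b → γᴺ (suc (a + b)) (suc a) * suc (suc (a + b)) ≡ (binom (suc b) (suc a) + binom b a) * binom (a + b) a
γᴺ-spec a b = trans (quotient-exact (Patterned-rotate _ {CyclicWord _ (suc a)} (CyclicWord-rotate _ _))
                                   (Patterned-size _ {CyclicWord _ (suc a)}) (card-Patterned-large a b))
                   (cong (_* binom (a + b) a) (cyclicCount-closed a b))

-- Dominating compositions as cyclic compositions

sum-take-suc : ∀ i (c : List ℕ) → i < length c → sum (take (suc i) c) ≡ sum (take i c) + nthD 0 c (suc i)
sum-take-suc zero    (x ∷ c) _   = +-identityʳ x
sum-take-suc (suc i) (x ∷ c) i<c = trans (cong (λ s → x + s) (sum-take-suc i c (s≤s⁻¹ i<c))) (sym (+-assoc x _ _))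

fc-prefix : ∀ c i → i ≤ length c → fc c 1 i ≡ ℤ.+ sum (take i c) - ℤ.+ (2 * i)
fc-prefix c zero    _   = refl
fc-prefix c (suc i) i<c = begin
  fc c 1 i ℤ.+ (ℤ.+ x - ℤ.+ 2)
    ≡⟨ cong (ℤ._+ (ℤ.+ x - ℤ.+ 2)) (fc-prefix c i (<⇒≤ i<c)) ⟩
  (ℤ.+ sum (take i c) - ℤ.+ (2 * i)) ℤ.+ (ℤ.+ x - ℤ.+ 2)
    ≡⟨ regroup (ℤ.+ sum (take i c)) (ℤ.+ x) (ℤ.+ (2 * i)) ⟩
  (ℤ.+ sum (take i c) ℤ.+ ℤ.+ x) - (ℤ.+ 2 ℤ.+ ℤ.+ (2 * i))
    ≡⟨ cong₂ _-_ (sym (ℤ.pos-+ (sum (take i c)) x)) (sym (ℤ.pos-+ 2 (2 * i))) ⟩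
  ℤ.+ (sum (take i c) + x) - ℤ.+ (2 + 2 * i)
    ≡⟨ cong₂ (λ a b → ℤ.+ a - ℤ.+ b) (sym (sum-take-suc i c i<c)) (sym (*-distribˡ-+ 2 1 i)) ⟩
  ℤ.+ sum (take (suc i) c) - ℤ.+ (2 * suc i) ∎
  where
  open ≡-Reasoning
  x = nthD 0 c (suc i)
  regroup : ∀ a x b → (a - b) ℤ.+ (x - ℤ.+ 2) ≡ (a ℤ.+ x) - (ℤ.+ 2 ℤ.+ b)
  regroup = ℤ-Solver.solve-∀

0<m-n⇔n<m : ∀ m n → (ℤ.+ 0 ℤ.< ℤ.+ m - ℤ.+ n) ⇔ (n < m)
0<m-n⇔n<m m n = mk⇔ to-< from-<
  where
  -≯0 : ∀ k → ¬ (ℤ.+ 0 ℤ.< ℤ.- (ℤ.+ k))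
  -≯0 zero    (ℤ.+<+ ())
  -≯0 (suc k) ()
  to-< : ℤ.+ 0 ℤ.< ℤ.+ m - ℤ.+ n → n < m
  to-< 0< with n <? m
  ... | yes n<m = n<m
  ... | no  n≮m = ⊥-elim (-≯0 (n ∸ m) (subst (ℤ.+ 0 ℤ.<_) (trans (ℤ.m-n≡m⊖n m n) (ℤ.⊖-≤ (≮⇒≥ n≮m))) 0<))
  from-< : n < m → ℤ.+ 0 ℤ.< ℤ.+ m - ℤ.+ n
  from-< n<m = subst (ℤ.+ 0 ℤ.<_) (sym (trans (ℤ.m-n≡m⊖n m n) (ℤ.⊖-≥ (<⇒≤ n<m)))) (ℤ.+<+ (m<n⇒0<n∸m n<m))

dominating⇔ : ∀ c → Dominating c ⇔ (∀ i → 1 ≤ i → i ≤ length c → 2 * i < sum (take i c))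
dominating⇔ c = mk⇔
  (λ dom i 1≤i i≤c → Equivalence.to (0<m-n⇔n<m _ _) (subst (ℤ.+ 0 ℤ.<_) (fc-prefix c i i≤c) (dom i 1≤i i≤c)))
  (λ h i 1≤i i≤c → subst (ℤ.+ 0 ℤ.<_) (sym (fc-prefix c i i≤c)) (Equivalence.from (0<m-n⇔n<m _ _) (h i 1≤i i≤c)))

toCyclic : List ℕ → List ℕ
toCyclic []       = []
toCyclic (x ∷ xs) = pred x ∷ xs ++ 1 ∷ []

dropLast : List ℕ → List ℕ
dropLast []           = []
dropLast (x ∷ [])     = []
dropLast (x ∷ y ∷ ys) = x ∷ dropLast (y ∷ ys)

fromCyclic : List ℕ → List ℕ
fromCyclic []       = []
fromCyclic (y ∷ ys) = suc y ∷ dropLast ys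

dropLast-snoc : ∀ xs x → dropLast (xs ++ x ∷ []) ≡ xs
dropLast-snoc []           x = refl
dropLast-snoc (y ∷ [])     x = refl
dropLast-snoc (y ∷ z ∷ xs) x = cong (y ∷_) (dropLast-snoc (z ∷ xs) x)

fromCyclic-toCyclic : ∀ x xs → 1 ≤ x → fromCyclic (toCyclic (x ∷ xs)) ≡ x ∷ xs
fromCyclic-toCyclic (suc x) xs _ = cong (suc x ∷_) (dropLast-snoc xs 1)

toCyclic-fromCyclic : ∀ y ys → toCyclic (fromCyclic (y ∷ ys ++ 1 ∷ [])) ≡ y ∷ ys ++ 1 ∷ []
toCyclic-fromCyclic y ys = cong (λ zs → y ∷ zs ++ 1 ∷ []) (dropLast-snoc ys 1)

length-snoc : ∀ (xs : List ℕ) x → length (xs ++ x ∷ []) ≡ suc (length xs)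
length-snoc xs x = trans (length-++ xs) (+-comm (length xs) 1)

sum-snoc-1 : ∀ xs → sum (xs ++ 1 ∷ []) ≡ suc (sum xs)
sum-snoc-1 xs = trans (sum-++ xs (1 ∷ [])) (+-comm (sum xs) 1)

IsComposition-toCyclic : ∀ {S k} x xs → 2 ≤ x → IsComposition S k (x ∷ xs) ⇔ IsComposition S (suc k) (toCyclic (x ∷ xs))
IsComposition-toCyclic (suc zero)    xs (s≤s ())
IsComposition-toCyclic (suc (suc x)) xs _ = mk⇔
  (λ { (_ ∷ pos , sum≡ , len) → s≤s z≤n ∷ All.++⁺ pos (s≤s z≤n ∷ []) ,
                                trans sum-toCyclic sum≡ , cong suc (trans (length-snoc xs 1) len) })
  (λ { (_ ∷ pos , sum≡ , len) → s≤s z≤n ∷ All.++⁻ˡ xs pos ,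
                                trans (sym sum-toCyclic) sum≡ , trans (sym (length-snoc xs 1)) (suc-injective len) })
  where
  sum-toCyclic : suc x + sum (xs ++ 1 ∷ []) ≡ suc (suc x) + sum xs
  sum-toCyclic = trans (cong (suc x +_) (sum-snoc-1 xs)) (+-suc (suc x) (sum xs))

sum-take-toCyclic : ∀ x xs {t} → 1 ≤ x → 1 ≤ t → t ≤ suc (length xs) →
                    suc (sum (take t (toCyclic (x ∷ xs)))) ≡ sum (take t (x ∷ xs))
sum-take-toCyclic (suc x) xs {suc t} _ _ t≤ = cong (λ p → suc (x + sum p)) (take-++ˡ xs (1 ∷ []) (s≤s⁻¹ t≤))

dominating⇔weaklyDominating : ∀ x xs → 1 ≤ x → Dominating (x ∷ xs) ⇔ WeaklyDominating (toCyclic (x ∷ xs))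
dominating⇔weaklyDominating x xs 1≤x = mk⇔
  (λ dom {t} t< 1≤t → let t≤ = s≤s⁻¹ (subst (t <_) (cong suc (length-snoc xs 1)) t<) in
     s≤s⁻¹ (subst (2 * t <_) (sym (sum-take-toCyclic x xs 1≤x 1≤t t≤)) (to (dominating⇔ (x ∷ xs)) dom t 1≤t t≤)))
  (λ wd → from (dominating⇔ (x ∷ xs)) λ i 1≤i i≤ →
     subst (2 * i <_) (sum-take-toCyclic x xs 1≤x 1≤i i≤)
       (s≤s (wd (subst (i <_) (sym (cong suc (length-snoc xs 1))) (s≤s i≤)) 1≤i)))

large-head : ∀ x xs → WeaklyDominating (toCyclic (x ∷ xs)) → 3 ≤ x
large-head x xs wd = at-least-3 x (wd {1} (subst (1 <_) (sym (cong suc (length-snoc xs 1))) (s≤s (s≤s z≤n))) (s≤s z≤n))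
  where
  at-least-3 : ∀ x → 2 ≤ pred x + 0 → 3 ≤ x
  at-least-3 (suc (suc (suc _))) _                 = s≤s (s≤s (s≤s z≤n))
  at-least-3 (suc (suc zero))    (s≤s ())

-- The first k parts already sum to at least 2k.
ends-with-one : ∀ k d → 1 ≤ k → IsComposition (2 * k + 1) (suc k) d → WeaklyDominating d →
                ∃₂ λ y ys → d ≡ y ∷ ys ++ 1 ∷ []
ends-with-one k d 1≤k (pos , sum≡ , len) wd with initLast d
... | zs ∷ʳ′ w = nonempty zs length-zs (≤-antisym w≤1 (singleton-positive (All.++⁻ʳ zs pos)))
  where
  length-zs : length zs ≡ k
  length-zs = suc-injective (trans (sym (length-snoc zs w)) len)
  2k≤zs : 2 * k ≤ sum zs
  2k≤zs = subst₂ (λ n p → 2 * n ≤ sum p) length-zs (take-length-++ zs (w ∷ []))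
            (wd (subst (length zs <_) (sym (length-snoc zs w)) ≤-refl) (subst (1 ≤_) (sym length-zs) 1≤k))
  w≤1 : w ≤ 1
  w≤1 = +-cancelˡ-≤ (2 * k) w 1 (≤-trans (+-monoˡ-≤ w 2k≤zs)
          (≤-reflexive (trans (cong (sum zs +_) (sym (+-identityʳ w))) (trans (sym (sum-++ zs (w ∷ []))) sum≡))))
  singleton-positive : All (1 ≤_) (w ∷ []) → 1 ≤ w
  singleton-positive (w≥1 ∷ []) = w≥1
  nonempty : ∀ zs → length zs ≡ k → w ≡ 1 → ∃₂ λ y ys → zs ++ w ∷ [] ≡ y ∷ ys ++ 1 ∷ []
  nonempty []       refl _    = ⊥-elim (<-irrefl refl 1≤k)
  nonempty (y ∷ ys) _    refl = y , ys , refl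

numBig≡ones : ∀ c → numBig c ≡ ones (shape c)
numBig≡ones []                = refl
numBig≡ones (zero        ∷ c) = numBig≡ones c
numBig≡ones (suc zero    ∷ c) = numBig≡ones c
numBig≡ones (suc (suc _) ∷ c) = cong suc (numBig≡ones c)

-- No two consecutive entries of x ∷ xs ++ 1 ∷ [] satisfy U; the final 1 is the convention c_{k+1} = 1.
NoAdjacent : (ℕ → Set) → ℕ → List ℕ → Set
NoAdjacent U x []       = ¬ (U x × U 1)
NoAdjacent U x (y ∷ ys) = ¬ (U x × U y) × NoAdjacent U y ys

AdjacentFree : (ℕ → Set) → List ℕ → Set
AdjacentFree U c = ∀ i → 1 ≤ i → i ≤ length c → ¬ (U (cext c i) × U (cext c (suc i)))

noAdjacent⇔adjacentFree : ∀ U x xs → NoAdjacent U x xs ⇔ AdjacentFree U (x ∷ xs)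
noAdjacent⇔adjacentFree U x xs = mk⇔ (forward x xs) (backward x xs)
  where
  forward : ∀ x xs → NoAdjacent U x xs → AdjacentFree U (x ∷ xs)
  forward x []       free       (suc zero)    _ _          = free
  forward x []       _          (suc (suc i)) _ (s≤s ())
  forward x (y ∷ ys) (free , _) (suc zero)    _ _          = free
  forward x (y ∷ ys) (_ , rest) (suc (suc i)) _ (s≤s i≤) = forward y ys rest (suc i) (s≤s z≤n) i≤
  backward : ∀ x xs → AdjacentFree U (x ∷ xs) → NoAdjacent U x xs
  backward x []       free = free 1 (s≤s z≤n) (s≤s z≤n)
  backward x (y ∷ ys) free = free 1 (s≤s z≤n) (s≤s z≤n) ,
                             backward y ys λ { (suc i) _ i≤ → free (suc (suc i)) (s≤s z≤n) (s≤s i≤) }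

∧≡false⇔ : ∀ p q → (p ∧ q ≡ false) ⇔ (¬ (p ≡ true × q ≡ true))
∧≡false⇔ true  true  = mk⇔ (λ ()) (λ both → ⊥-elim (both (refl , refl)))
∧≡false⇔ true  false = mk⇔ (λ _ ()) (λ _ → refl)
∧≡false⇔ false q     = mk⇔ (λ _ ()) (λ _ → refl)

module _ {U : ℕ → Set} (f : ℕ → Bool) (f-spec : ∀ a → 1 ≤ a → f a ≡ true ⇔ U a) where

  not-both⇔ : ∀ {a b} → 1 ≤ a → 1 ≤ b → (¬ (U a × U b)) ⇔ (f a ∧ f b ≡ false)
  not-both⇔ {a} {b} 1≤a 1≤b = mk⇔
    (λ ¬UU → from (∧≡false⇔ (f a) (f b)) λ (fa , fb) → ¬UU (to (f-spec a 1≤a) fa , to (f-spec b 1≤b) fb))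
    (λ f∧f (ua , ub) → to (∧≡false⇔ (f a) (f b)) f∧f (from (f-spec a 1≤a) ua , from (f-spec b 1≤b) ub))

  noAdjacent⇔sparse : ∀ x xs → 1 ≤ x → All (1 ≤_) xs → NoAdjacent U x xs ⇔ SparseBetween (f x) (map f xs) (f 1)
  noAdjacent⇔sparse x []       1≤x []           = not-both⇔ 1≤x (s≤s z≤n)
  noAdjacent⇔sparse x (y ∷ ys) 1≤x (1≤y ∷ pos) = mk⇔
    (λ (free , rest) → to (not-both⇔ 1≤x 1≤y) free , to (noAdjacent⇔sparse y ys 1≤y pos) rest)
    (λ (sparse , rest) → from (not-both⇔ 1≤x 1≤y) sparse , from (noAdjacent⇔sparse y ys 1≤y pos) rest)

dnuEmpty⇔adjacentFree : ∀ c → DnuEmpty c ⇔ AdjacentFree (1 <_) c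
dnuEmpty⇔adjacentFree c = mk⇔ (λ empty i 1≤i i≤ both → empty i (1≤i , i≤ , both))
                               (λ free i (1≤i , i≤ , both) → free i 1≤i i≤ both)

doEmpty⇔adjacentFree : ∀ c → DoEmpty c ⇔ AdjacentFree (_≡ 1) c
doEmpty⇔adjacentFree c = mk⇔ (λ empty i 1≤i i≤ both → empty i (1≤i , i≤ , both))
                              (λ free i (1≤i , i≤ , both) → free i 1≤i i≤ both)

isLarge-spec : ∀ a → 1 ≤ a → isLarge a ≡ true ⇔ 1 < a
isLarge-spec (suc (suc a)) _ = mk⇔ (λ _ → s≤s (s≤s z≤n)) (λ _ → refl)
isLarge-spec (suc zero)    _ = mk⇔ (λ ()) (λ { (s≤s ()) })

isOne-spec : ∀ a → 1 ≤ a → not (isLarge a) ≡ true ⇔ a ≡ 1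
isOne-spec (suc (suc a)) _ = mk⇔ (λ ()) (λ ())
isOne-spec (suc zero)    _ = mk⇔ (λ _ → refl) (λ _ → refl)

sparse-snoc : ∀ p bs b q → b ∧ q ≡ false → SparseBetween p bs b ⇔ SparseBetween p (bs ++ b ∷ []) q
sparse-snoc p bs b q b∧q = mk⇔ (λ sparse → from (SparseBetween-++ p bs b q) (sparse , b∧q))
                                (proj₁ ∘ to (SparseBetween-++ p bs b q))

dnuEmpty⇔ : ∀ x xs → 3 ≤ x → All (1 ≤_) xs → DnuEmpty (x ∷ xs) ⇔ CyclicallySparse (shape (toCyclic (x ∷ xs)))
dnuEmpty⇔ x xs (s≤s (s≤s (s≤s _))) pos = begin
  DnuEmpty (x ∷ xs)                                ≈⟨ dnuEmpty⇔adjacentFree (x ∷ xs) ⟩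
  AdjacentFree (1 <_) (x ∷ xs)                     ≈⟨ noAdjacent⇔adjacentFree (1 <_) x xs ⟨
  NoAdjacent (1 <_) x xs                           ≈⟨ noAdjacent⇔sparse isLarge isLarge-spec x xs (s≤s z≤n) pos ⟩
  SparseBetween true (shape xs) false              ≈⟨ sparse-snoc true (shape xs) false true refl ⟩
  SparseBetween true (shape xs ++ false ∷ []) true ≡⟨ cong (λ bs → SparseBetween true bs true) (map-++ isLarge xs (1 ∷ [])) ⟨
  CyclicallySparse (shape (toCyclic (x ∷ xs)))     ∎
  where open import Relation.Binary.Reasoning.Setoid (⇔-setoid 0ℓ)

doEmpty⇔ : ∀ x xs → 3 ≤ x → All (1 ≤_) xs → DoEmpty (x ∷ xs) ⇔ CyclicallySparse (map not (shape (toCyclic (x ∷ xs))))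
doEmpty⇔ x xs (s≤s (s≤s (s≤s _))) pos = begin
  DoEmpty (x ∷ xs)                                            ≈⟨ doEmpty⇔adjacentFree (x ∷ xs) ⟩
  AdjacentFree (_≡ 1) (x ∷ xs)                                ≈⟨ noAdjacent⇔adjacentFree (_≡ 1) x xs ⟨
  NoAdjacent (_≡ 1) x xs                                      ≈⟨ noAdjacent⇔sparse (not ∘ isLarge) isOne-spec x xs (s≤s z≤n) pos ⟩
  SparseBetween false (map (not ∘ isLarge) xs) true           ≈⟨ sparse-snoc false (map (not ∘ isLarge) xs) true false refl ⟩
  SparseBetween false (map (not ∘ isLarge) xs ++ true ∷ []) false
    ≡⟨ cong (λ bs → SparseBetween false bs false) (trans (sym (map-∘ (xs ++ 1 ∷ []))) (map-++ (not ∘ isLarge) xs (1 ∷ []))) ⟨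
  CyclicallySparse (map not (shape (toCyclic (x ∷ xs))))      ∎
  where open import Relation.Binary.Reasoning.Setoid (⇔-setoid 0ℓ)

length-shape-toCyclic : ∀ x xs → length (shape (toCyclic (x ∷ xs))) ≡ suc (length (x ∷ xs))
length-shape-toCyclic x xs = trans (length-map isLarge (toCyclic (x ∷ xs))) (cong suc (length-snoc xs 1))

ones-shape-toCyclic : ∀ x xs → 3 ≤ x → ones (shape (toCyclic (x ∷ xs))) ≡ numBig (x ∷ xs)
ones-shape-toCyclic x xs (s≤s (s≤s (s≤s _))) = cong suc (begin
  ones (shape (xs ++ 1 ∷ []))           ≡⟨ cong ones (map-++ isLarge xs (1 ∷ [])) ⟩
  ones (shape xs ++ false ∷ [])         ≡⟨ ones-++ (shape xs) (false ∷ []) ⟩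
  ones (shape xs) + 0                   ≡⟨ +-identityʳ _ ⟩
  ones (shape xs)                       ≡⟨ numBig≡ones xs ⟨
  numBig xs                             ∎)
  where open ≡-Reasoning

card-fromCyclic : ∀ {k n} {W : List Bool → Set} {F : List ℕ → Set} → 1 ≤ k →
  (∀ x xs → 3 ≤ x → IsComposition (2 * k + 1) k (x ∷ xs) → F (x ∷ xs) ⇔ W (shape (toCyclic (x ∷ xs)))) →
  Card (λ d → Patterned k W d × WeaklyDominating d) n →
  Card (λ c → (IsComposition (2 * k + 1) k c × Dominating c) × F c) n
card-fromCyclic {k} {W = W} {F} 1≤k F⇔W = Card-inverse fromCyclic toCyclic into back to-from from-to
  where
  Cyc Lin : List ℕ → Set
  Cyc d = Patterned k W d × WeaklyDominating d
  Lin c = (IsComposition (2 * k + 1) k c × Dominating c) × F c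

  lin : ∀ x xs → 1 ≤ x → Cyc (toCyclic (x ∷ xs)) → Lin (x ∷ xs)
  lin x xs 1≤x ((comp , w) , wd) = (comp′ , from (dominating⇔weaklyDominating x xs 1≤x) wd) , from (F⇔W x xs 3≤x comp′) w
    where
    3≤x = large-head x xs wd
    comp′ = from (IsComposition-toCyclic x xs (≤-trans (s≤s (s≤s z≤n)) 3≤x)) comp

  into : ∀ d → Cyc d → Lin (fromCyclic d)
  into d cyc@((comp , _) , wd) with ends-with-one k d 1≤k comp wd
  ... | y , ys , refl = subst Lin (sym (cong (suc y ∷_) (dropLast-snoc ys 1))) (lin (suc y) ys (s≤s z≤n) cyc)

  back : ∀ c → Lin c → Cyc (toCyclic c)
  back []       (((_ , sum≡ , _) , _) , _) = ⊥-elim (0≢1+n (trans sum≡ (+-comm (2 * k) 1)))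
  back (x ∷ xs) ((comp , dom) , f) =
    (to (IsComposition-toCyclic x xs (≤-trans (s≤s (s≤s z≤n)) 3≤x)) comp , to (F⇔W x xs 3≤x comp) f) ,
    to (dominating⇔weaklyDominating x xs (≤-trans (s≤s z≤n) 3≤x)) dom
    where
    3≤x : 3 ≤ x
    3≤x = subst (3 ≤_) (+-identityʳ x) (to (dominating⇔ (x ∷ xs)) dom 1 (s≤s z≤n) (s≤s z≤n))

  from-to : ∀ c → Lin c → fromCyclic (toCyclic c) ≡ c
  from-to []       _ = refl
  from-to (x ∷ xs) (((1≤x ∷ _ , _) , _) , _) = fromCyclic-toCyclic x xs 1≤x

  to-from : ∀ d → Cyc d → toCyclic (fromCyclic d) ≡ d
  to-from d ((comp , _) , wd) with ends-with-one k d 1≤k comp wd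
  ... | y , ys , refl = toCyclic-fromCyclic y ys

card-DnuEmpty : ∀ {k j n} → 1 ≤ k →
                Card (λ d → Patterned k (CyclicWord (suc k) j) d × WeaklyDominating d) n →
                Card (λ c → DComp k j c × DnuEmpty c) n
card-DnuEmpty {k} {j} 1≤k card =
  Card-resp-⇔ (λ _ → reassoc) (card-fromCyclic {W = CyclicWord (suc k) j} 1≤k same-pattern card)
  where
  reassoc : ∀ {A B C D : Set} → ((A × B) × C × D) ⇔ ((A × B × C) × D)
  reassoc = mk⇔ (λ ((a , b) , c , d) → (a , b , c) , d) (λ ((a , b , c) , d) → (a , b) , c , d)
  same-pattern : ∀ x xs → 3 ≤ x → IsComposition (2 * k + 1) k (x ∷ xs) →
            (numBig (x ∷ xs) ≡ j × DnuEmpty (x ∷ xs)) ⇔ CyclicWord (suc k) j (shape (toCyclic (x ∷ xs)))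
  same-pattern x xs 3≤x (_ ∷ pos , _ , len) = mk⇔
    (λ (big , empty) → trans (length-shape-toCyclic x xs) (cong suc len) ,
                       trans (ones-shape-toCyclic x xs 3≤x) big , to (dnuEmpty⇔ x xs 3≤x pos) empty)
    (λ (_ , ones≡ , sparse) → trans (sym (ones-shape-toCyclic x xs 3≤x)) ones≡ , from (dnuEmpty⇔ x xs 3≤x pos) sparse)

card-DoEmpty : ∀ {k j n} → 1 ≤ k → j ≤ k →
               Card (λ d → Patterned k (CyclicWord (suc k) j ∘ map not) d × WeaklyDominating d) n →
               Card (λ c → DComp k (k ∸ j + 1) c × DoEmpty c) n
card-DoEmpty {k} {j} 1≤k j≤k card =
  Card-resp-⇔ (λ _ → reassoc) (card-fromCyclic {W = CyclicWord (suc k) j ∘ map not} 1≤k same-pattern card)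
  where
  reassoc : ∀ {A B C D : Set} → ((A × B) × C × D) ⇔ ((A × B × C) × D)
  reassoc = mk⇔ (λ ((a , b) , c , d) → (a , b , c) , d) (λ ((a , b , c) , d) → (a , b) , c , d)
  complement : j + (k ∸ j + 1) ≡ suc k
  complement = trans (sym (+-assoc j (k ∸ j) 1)) (trans (cong (_+ 1) (m+[n∸m]≡n j≤k)) (+-comm k 1))
  same-pattern : ∀ x xs → 3 ≤ x → IsComposition (2 * k + 1) k (x ∷ xs) →
            (numBig (x ∷ xs) ≡ k ∸ j + 1 × DoEmpty (x ∷ xs)) ⇔ CyclicWord (suc k) j (map not (shape (toCyclic (x ∷ xs))))
  same-pattern x xs 3≤x (_ ∷ pos , _ , len) = mk⇔
    (λ (big , empty) → trans (length-map not bs) length-bs ,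
                       +-cancelʳ-≡ (ones bs) _ j (trans total (trans (sym complement) (cong (j +_) (sym (trans (ones-shape-toCyclic x xs 3≤x) big))))) ,
                       to (doEmpty⇔ x xs 3≤x pos) empty)
    (λ (_ , ones≡ , sparse) → trans (sym (ones-shape-toCyclic x xs 3≤x))
                                (+-cancelˡ-≡ j _ _ (trans (cong (_+ ones bs) (sym ones≡)) (trans total (sym complement)))) ,
                              from (doEmpty⇔ x xs 3≤x pos) sparse)
    where
    bs = shape (toCyclic (x ∷ xs))
    length-bs : length bs ≡ suc k
    length-bs = trans (length-shape-toCyclic x xs) (cong suc len)
    total : ones (map not bs) + ones bs ≡ suc k
    total = trans (ones-not bs) length-bs

card-Dnu : ∀ k j → 1 ≤ j → j ≤ k → Card (λ c → DComp k j c × DnuEmpty c) (γᴺ k j)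
card-Dnu k (suc a) _ a<k with m≤n⇒∃[o]m+o≡n a<k
... | b , refl = card-DnuEmpty (s≤s z≤n)
  (card-Patterned-weaklyDominating _ {CyclicWord _ (suc a)} (CyclicWord-rotate _ _) (card-Patterned-large a b))

card-Do : ∀ k j → 1 ≤ j → j ≤ k → Card (λ c → DComp k (k ∸ j + 1) c × DoEmpty c) (γᴺ k j)
card-Do k (suc a) _ a<k with m≤n⇒∃[o]m+o≡n a<k
... | b , refl = card-DoEmpty (s≤s z≤n) a<k
  (card-Patterned-weaklyDominating _ {CyclicWord _ (suc a) ∘ map not} (CyclicWord-not-rotate _ _) (card-Patterned-one a b))

-- Coefficients of both sides

⊛-single : ∀ p q t → (∀ i → i ≢ t → p i ≡ 0) → ∀ n → t ≤ n → (p ⊛ q) n ≡ p t * q (n ∸ t)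
⊛-single p q t p≡0 n t≤n = sumTo-single (suc n) t (λ i i≢t → cong (_* q (n ∸ i)) (p≡0 i i≢t)) (s≤s t≤n)

⊛-single-< : ∀ p q t → (∀ i → i ≢ t → p i ≡ 0) → ∀ n → n < t → (p ⊛ q) n ≡ 0
⊛-single-< p q t p≡0 n n<t = sumTo-zero (suc n) λ i i≤n → cong (_* q (n ∸ i)) (p≡0 i λ { refl → <⇒≱ n<t (s≤s⁻¹ i≤n) })

tP-off : ∀ i → i ≢ 1 → tP i ≡ 0
tP-off zero          _   = refl
tP-off (suc zero)    i≢1 = ⊥-elim (i≢1 refl)
tP-off (suc (suc i)) _   = refl

tP^-off : ∀ m i → i ≢ m → (tP ^ₚ m) i ≡ 0
tP^-off zero    zero    i≢m = ⊥-elim (i≢m refl)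
tP^-off zero    (suc i) _   = refl
tP^-off (suc m) zero    _   = ⊛-single-< tP (tP ^ₚ m) 1 tP-off 0 (s≤s z≤n)
tP^-off (suc m) (suc i) i≢m = trans (⊛-single tP (tP ^ₚ m) 1 tP-off (suc i) (s≤s z≤n))
                                     (trans (+-identityʳ _) (tP^-off m i (i≢m ∘ cong suc)))

tP^-diag : ∀ m → (tP ^ₚ m) m ≡ 1
tP^-diag zero    = refl
tP^-diag (suc m) = trans (⊛-single tP (tP ^ₚ m) 1 tP-off (suc m) (s≤s z≤n)) (trans (+-identityʳ _) (tP^-diag m))

tP^-⊛ : ∀ j q n → j ≤ n → ((tP ^ₚ j) ⊛ q) n ≡ q (n ∸ j)
tP^-⊛ j q n j≤n = trans (⊛-single (tP ^ₚ j) q j (tP^-off j) n j≤n) (trans (cong (_* q (n ∸ j)) (tP^-diag j)) (+-identityʳ _))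

tP^-⊛-< : ∀ j q n → n < j → ((tP ^ₚ j) ⊛ q) n ≡ 0
tP^-⊛-< j q = ⊛-single-< (tP ^ₚ j) q j (tP^-off j)

[1+t]^-coeff : ∀ r i → ((constP 1 ⊕ tP) ^ₚ r) i ≡ binom r i
[1+t]^-coeff zero    zero    = refl
[1+t]^-coeff zero    (suc i) = refl
[1+t]^-coeff (suc r) i = begin
  sumTo (suc i) (λ l → (constP 1 l + tP l) * q (i ∸ l))
    ≡⟨ sumTo-cong (suc i) (λ l _ → *-distribʳ-+ (q (i ∸ l)) (constP 1 l) (tP l)) ⟩
  sumTo (suc i) (λ l → constP 1 l * q (i ∸ l) + tP l * q (i ∸ l))
    ≡⟨ sumTo-+ (suc i) _ _ ⟩
  (constP 1 ⊛ q) i + (tP ⊛ q) i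
    ≡⟨ cong₂ _+_ (trans (⊛-single (constP 1) q 0 const-off i z≤n) (trans (+-identityʳ _) ([1+t]^-coeff r i))) (shifted i) ⟩
  binom r i + binom-shifted i
    ≡⟨ pascal i ⟩
  binom (suc r) i ∎
  where
  open ≡-Reasoning
  q = (constP 1 ⊕ tP) ^ₚ r
  const-off : ∀ i → i ≢ 0 → constP 1 i ≡ 0
  const-off zero    i≢0 = ⊥-elim (i≢0 refl)
  const-off (suc i) _   = refl
  binom-shifted : ℕ → ℕ
  binom-shifted zero    = 0
  binom-shifted (suc i) = binom r i
  shifted : ∀ i → (tP ⊛ q) i ≡ binom-shifted i
  shifted zero    = ⊛-single-< tP q 1 tP-off zero (s≤s z≤n)
  shifted (suc i) = trans (⊛-single tP q 1 tP-off (suc i) (s≤s z≤n)) (trans (+-identityʳ _) ([1+t]^-coeff r i))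
  pascal : ∀ i → binom r i + binom-shifted i ≡ binom (suc r) i
  pascal zero    = +-identityʳ _
  pascal (suc i) = +-comm (binom r (suc i)) (binom r i)

-- Multiplying by (a + 1)(k + 1) clears the division hidden in γᴺ; what remains is binom-multinomial.
γᴺ-term-identity : ∀ a u w g →
  g * suc (suc (a + (a + (u + w)))) ≡ (binom (suc (a + (u + w))) (suc a) + binom (a + (u + w)) a) * binom (a + (a + (u + w))) a →
  suc (a + w) * (g * binom (u + w) u) ≡ binom ((a + u) + (a + w)) (a + u) * (binom (a + u) a * binom (suc (a + w)) (suc a))
γᴺ-term-identity a u w g hg = *-cancelˡ-≡ _ _ (suc a * K) (begin
  suc a * K * (suc q * (g * c))                  ≡⟨ e₁ (suc a) K (suc q) g c ⟩
  suc q * c * (suc a * (g * K))                  ≡⟨ cong (λ x → suc q * c * (suc a * x)) hg ⟩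
  suc q * c * (suc a * ((B₁ + B₂) * D))          ≡⟨ e₂ (suc q) c (suc a) (B₁ + B₂) D ⟩
  suc q * c * D * (suc a * (B₁ + B₂))            ≡⟨ cong (suc q * c * D *_) (binom-absorb-pascal a b) ⟩
  suc q * c * D * (K * B₂)                       ≡⟨ e₃ (suc q) c D K B₂ ⟩
  suc q * K * (B₂ * D * c)                       ≡⟨ cong (suc q * K *_) (binom-multinomial a u w) ⟩
  suc q * K * (E₁ * E₂ * binom q a)              ≡⟨ e₄ (suc q) K E₁ E₂ (binom q a) ⟩
  E₁ * E₂ * (suc q * binom q a) * K              ≡⟨ cong (λ x → E₁ * E₂ * x * K) (binom-absorb q a) ⟨
  E₁ * E₂ * (suc a * binom (suc q) (suc a)) * K  ≡⟨ e₅ E₁ E₂ (suc a) (binom (suc q) (suc a)) K ⟩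
  suc a * K * (E₁ * (E₂ * binom (suc q) (suc a))) ∎)
  where
  open ≡-Reasoning
  b = a + (u + w)
  q = a + w
  K = suc (suc (a + b))
  c = binom (u + w) u
  B₁ = binom (suc b) (suc a)
  B₂ = binom b a
  D = binom (a + b) a
  E₁ = binom ((a + u) + (a + w)) (a + u)
  E₂ = binom (a + u) a
  e₁ : ∀ a K q g c → a * K * (q * (g * c)) ≡ q * c * (a * (g * K))
  e₁ = solve-∀
  e₂ : ∀ q c a B D → q * c * (a * (B * D)) ≡ q * c * D * (a * B)
  e₂ = solve-∀
  e₃ : ∀ q c D K B → q * c * D * (K * B) ≡ q * K * (B * D * c)
  e₃ = solve-∀
  e₄ : ∀ q K x y z → q * K * (x * y * z) ≡ x * y * (q * z) * K
  e₄ = solve-∀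
  e₅ : ∀ x y a z K → x * y * (a * z) * K ≡ a * K * (x * (y * z))
  e₅ = solve-∀

γᴺ-monomial : ℕ → ℕ → ℕ → ℕ
γᴺ-monomial k a n = ((tP ^ₚ suc a) ⊛ ((constP 1 ⊕ tP) ^ₚ (k + 1 ∸ 2 * suc a))) n

γᴺ-monomial-≤ : ∀ k a p → a ≤ p → γᴺ-monomial k a (suc p) ≡ binom (k + 1 ∸ 2 * suc a) (p ∸ a)
γᴺ-monomial-≤ k a p a≤p =
  trans (tP^-⊛ (suc a) ((constP 1 ⊕ tP) ^ₚ (k + 1 ∸ 2 * suc a)) (suc p) (s≤s a≤p)) ([1+t]^-coeff (k + 1 ∸ 2 * suc a) (p ∸ a))

*-zeroʳ′ : ∀ m {n} → n ≡ 0 → m * n ≡ 0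
*-zeroʳ′ m refl = *-zeroʳ m

γᴺ-monomial-< : ∀ k a p → p < a → γᴺ-monomial k a (suc p) ≡ 0
γᴺ-monomial-< k a p p<a = tP^-⊛-< (suc a) ((constP 1 ⊕ tP) ^ₚ (k + 1 ∸ 2 * suc a)) (suc p) (s≤s p<a)

-- For k ≤ p + a the exponent of 1 + t is too small to reach t^(p+1).
γᴺ-monomial-vanishes : ∀ k a p → 2 * suc a ≤ k + 1 → k ≤ p + a → γᴺ-monomial k a (suc p) ≡ 0
γᴺ-monomial-vanishes k a p bound k≤p+a with a ≤? p
... | no  a≰p = γᴺ-monomial-< k a p (≰⇒> a≰p)
... | yes a≤p with m≤n⇒∃[o]m+o≡n bound | m≤n⇒∃[o]m+o≡n a≤p
...   | r , 2a+2+r≡k+1 | s , refl = trans (γᴺ-monomial-≤ k a (a + s) a≤p) (binom-> r<s′)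
  where
  r<s′ : k + 1 ∸ 2 * suc a < a + s ∸ a
  r<s′ = subst₂ _<_ (trans (sym (m+n∸m≡n (2 * suc a) r)) (cong (_∸ 2 * suc a) 2a+2+r≡k+1)) (sym (m+n∸m≡n a s))
           (+-cancelˡ-≤ (2 * a + 1) (suc r) s (subst₂ _≤_ (e₁ a r) (e₂ a s)
             (≤-trans (≤-reflexive 2a+2+r≡k+1) (+-monoˡ-≤ 1 k≤p+a))))
    where
    e₁ : ∀ a r → 2 * suc a + r ≡ 2 * a + 1 + suc r
    e₁ = solve-∀
    e₂ : ∀ a s → a + s + a + 1 ≡ 2 * a + 1 + s
    e₂ = solve-∀

γᴺ-sum : ℕ → ℕ → ℕ
γᴺ-sum k n = sumTo ((k + 1) / 2) (λ a → γᴺ k (suc a) * γᴺ-monomial k a n)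

half-bound : ∀ k j → j ≤ (k + 1) / 2 → 2 * j ≤ k + 1
half-bound k j j≤ = ≤-trans (≤-reflexive (*-comm 2 j)) (≤-trans (*-monoˡ-≤ 2 j≤) (m/n*n≤m (k + 1) 2))

half-bound-≤ : ∀ k j → 1 ≤ j → j ≤ (k + 1) / 2 → j ≤ k
half-bound-≤ k j 1≤j j≤ = +-cancelʳ-≤ 1 j k
  (≤-trans (+-monoʳ-≤ j 1≤j) (subst (_≤ k + 1) (cong (j +_) (+-identityʳ j)) (half-bound k j j≤)))

half-bound-min : ∀ p q → suc (p ⊓ q) ≤ (suc (p + q) + 1) / 2
half-bound-min p q = subst (_≤ (suc (p + q) + 1) / 2) (m*n/n≡m (suc (p ⊓ q)) 2) (/-monoˡ-≤ 2 twice)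
  where
  twice : suc (p ⊓ q) * 2 ≤ suc (p + q) + 1
  twice = subst₂ _≤_ (e₁ (p ⊓ q)) (e₂ p q) (s≤s (s≤s (+-mono-≤ (m⊓n≤m p q) (m⊓n≤n p q))))
    where
    e₁ : ∀ m → suc (suc (m + m)) ≡ suc m * 2
    e₁ = solve-∀
    e₂ : ∀ p q → suc (suc (p + q)) ≡ suc (p + q) + 1
    e₂ = solve-∀

γᴺ-term : ∀ p q a → 2 * suc a ≤ suc (p + q) + 1 →
  suc q * (γᴺ (suc (p + q)) (suc a) * γᴺ-monomial (suc (p + q)) a (suc p)) ≡ binom (p + q) p * (binom p a * binom (suc q) (suc a))
γᴺ-term p q a bound with a ≤? p | a ≤? q
... | no a≰p | _ =
  trans (*-zeroʳ′ (suc q) (*-zeroʳ′ (γᴺ (suc (p + q)) (suc a)) (γᴺ-monomial-< (suc (p + q)) a p (≰⇒> a≰p))))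
        (sym (*-zeroʳ′ (binom (p + q) p) (trans (cong (_* binom (suc q) (suc a)) (binom-> (≰⇒> a≰p))) refl)))
... | yes _ | no a≰q =
  trans (*-zeroʳ′ (suc q) (*-zeroʳ′ (γᴺ (suc (p + q)) (suc a))
          (γᴺ-monomial-vanishes (suc (p + q)) a p bound (subst (_≤ p + a) (+-suc p q) (+-monoʳ-≤ p (≰⇒> a≰q))))))
        (sym (*-zeroʳ′ (binom (p + q) p) (*-zeroʳ′ (binom p a) (binom-> (s≤s (≰⇒> a≰q))))))
... | yes a≤p | yes a≤q with m≤n⇒∃[o]m+o≡n a≤p | m≤n⇒∃[o]m+o≡n a≤q
...   | u , refl | w , refl =
  trans (cong₂ (λ g x → suc (a + w) * (g * x)) (cong (λ m → γᴺ (suc m) (suc a)) (sym regroup)) monomial)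
        (γᴺ-term-identity a u w (γᴺ (suc (a + (a + (u + w)))) (suc a)) (γᴺ-spec a (a + (u + w))))
  where
  regroup : a + (a + (u + w)) ≡ (a + u) + (a + w)
  regroup = e a u w
    where
    e : ∀ a u w → a + (a + (u + w)) ≡ (a + u) + (a + w)
    e = solve-∀
  monomial : γᴺ-monomial (suc ((a + u) + (a + w))) a (suc (a + u)) ≡ binom (u + w) u
  monomial = trans (γᴺ-monomial-≤ (suc ((a + u) + (a + w))) a (a + u) a≤p) (cong₂ binom exponent (m+n∸m≡n a u))
    where
    e : ∀ a u w → suc ((a + u) + (a + w)) + 1 ≡ 2 * suc a + (u + w)
    e = solve-∀
    exponent : suc ((a + u) + (a + w)) + 1 ∸ 2 * suc a ≡ u + w
    exponent = trans (cong (_∸ 2 * suc a) (e a u w)) (m+n∸m≡n (2 * suc a) (u + w))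

γᴺ-sum-mid : ∀ p q → suc q * γᴺ-sum (suc (p + q)) (suc p) ≡ binom (p + q) p * binom (p + suc q) (suc p)
γᴺ-sum-mid p q = begin
  suc q * sumTo J (λ a → γᴺ k (suc a) * γᴺ-monomial k a (suc p))
    ≡⟨ sumTo-*ˡ J (suc q) _ ⟨
  sumTo J (λ a → suc q * (γᴺ k (suc a) * γᴺ-monomial k a (suc p)))
    ≡⟨ sumTo-cong J (λ a a<J → γᴺ-term p q a (half-bound k (suc a) a<J)) ⟩
  sumTo J (λ a → binom (p + q) p * h a)
    ≡⟨ sumTo-*ˡ J (binom (p + q) p) h ⟩
  binom (p + q) p * sumTo J h
    ≡⟨ cong (binom (p + q) p *_) (trans (sumTo-truncate (suc (p ⊓ q)) J (half-bound-min p q) vanish)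
                                        (sym (sumTo-truncate (suc (p ⊓ q)) (suc p) (s≤s (m⊓n≤m p q)) vanish))) ⟩
  binom (p + q) p * sumTo (suc p) h
    ≡⟨ cong (binom (p + q) p *_) (vandermonde p (suc q) 1) ⟩
  binom (p + q) p * binom (p + suc q) (suc p) ∎
  where
  open ≡-Reasoning
  k = suc (p + q)
  J = (k + 1) / 2
  h : ℕ → ℕ
  h a = binom p a * binom (suc q) (suc a)
  vanish : ∀ a → suc (p ⊓ q) ≤ a → h a ≡ 0
  vanish a min<a with ≤-total p q
  ... | inj₁ p≤q = cong (_* binom (suc q) (suc a)) (binom-> (subst (_< a) (m≤n⇒m⊓n≡m p≤q) min<a))
  ... | inj₂ q≤p = *-zeroʳ′ (binom p a) (binom-> (s≤s (subst (_< a) (m≥n⇒m⊓n≡n q≤p) min<a)))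

narayana≡γᴺ-sum : ∀ p q → narayana (suc (p + q)) (suc p) ≡ γᴺ-sum (suc (p + q)) (suc p)
narayana≡γᴺ-sum p q = begin
  ((k C suc p) * (k C p)) / k                  ≡⟨ cong (_/ k) (cong₂ _*_ (sym (binom≡C k (suc p))) (sym (binom≡C k p))) ⟩
  (binom k (suc p) * binom k p) / k            ≡⟨ cong (_/ k) (*-cancelˡ-≡ _ _ (suc q) scaled) ⟩
  (γᴺ-sum k (suc p) * k) / k                   ≡⟨ m*n/n≡m (γᴺ-sum k (suc p)) k ⟩
  γᴺ-sum k (suc p)                             ∎
  where
  open ≡-Reasoning
  k = suc (p + q)
  scaled : suc q * (binom k (suc p) * binom k p) ≡ suc q * (γᴺ-sum k (suc p) * k)
  scaled = begin
    suc q * (binom k (suc p) * binom k p)                ≡⟨ e₁ (suc q) (binom k (suc p)) (binom k p) ⟩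
    suc q * binom k p * binom k (suc p)                  ≡⟨ cong₂ _*_ (binom-absorb-sym p q) (cong (λ n → binom n (suc p)) (sym (+-suc p q))) ⟩
    k * binom (p + q) p * binom (p + suc q) (suc p)      ≡⟨ e₂ k (binom (p + q) p) (binom (p + suc q) (suc p)) ⟩
    binom (p + q) p * binom (p + suc q) (suc p) * k      ≡⟨ cong (_* k) (γᴺ-sum-mid p q) ⟨
    suc q * γᴺ-sum k (suc p) * k                         ≡⟨ *-assoc (suc q) (γᴺ-sum k (suc p)) k ⟩
    suc q * (γᴺ-sum k (suc p) * k)                       ∎
    where
    e₁ : ∀ q x y → q * (x * y) ≡ q * y * x
    e₁ = solve-∀
    e₂ : ∀ k x y → k * x * y ≡ x * y * k
    e₂ = solve-∀

γᴺ-sum-0 : ∀ k → γᴺ-sum k 0 ≡ 0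
γᴺ-sum-0 k = sumTo-zero ((k + 1) / 2) λ a _ →
  *-zeroʳ′ (γᴺ k (suc a)) (tP^-⊛-< (suc a) ((constP 1 ⊕ tP) ^ₚ (k + 1 ∸ 2 * suc a)) 0 (s≤s z≤n))

γᴺ-sum-≥ : ∀ k p → k ≤ p → γᴺ-sum k (suc p) ≡ 0
γᴺ-sum-≥ k p k≤p = sumTo-zero ((k + 1) / 2) λ a a<J →
  *-zeroʳ′ (γᴺ k (suc a)) (γᴺ-monomial-vanishes k a p (half-bound k (suc a) a<J) (≤-trans k≤p (m≤m+n p a)))

monomial-off : ∀ c m n → n ≢ m → c * (tP ^ₚ m) n ≡ 0
monomial-off c m n n≢m = *-zeroʳ′ c (tP^-off m n n≢m)

narayanaPoly-0 : ∀ k .{{_ : NonZero k}} → narayanaPoly k 0 ≡ 0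
narayanaPoly-0 k = sumTo-zero k λ i _ → monomial-off (narayana k (suc i)) (suc i) 0 (λ ())

narayanaPoly-< : ∀ k .{{_ : NonZero k}} p → p < k → narayanaPoly k (suc p) ≡ narayana k (suc p)
narayanaPoly-< k p p<k = begin
  narayanaPoly k (suc p)                          ≡⟨ sumTo-single k p (λ i i≢p → monomial-off (narayana k (suc i)) (suc i) (suc p) (i≢p ∘ sym ∘ suc-injective)) p<k ⟩
  narayana k (suc p) * (tP ^ₚ suc p) (suc p)      ≡⟨ cong (narayana k (suc p) *_) (tP^-diag (suc p)) ⟩
  narayana k (suc p) * 1                          ≡⟨ *-identityʳ _ ⟩
  narayana k (suc p)                              ∎
  where open ≡-Reasoning

narayanaPoly-≥ : ∀ k .{{_ : NonZero k}} p → k ≤ p → narayanaPoly k (suc p) ≡ 0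
narayanaPoly-≥ k p k≤p = sumTo-zero k λ i i<k →
  monomial-off (narayana k (suc i)) (suc i) (suc p) λ eq → <-irrefl (sym (suc-injective eq)) (<-≤-trans i<k k≤p)

narayanaPoly≈γᴺ-sum : ∀ k .{{_ : NonZero k}} n → narayanaPoly k n ≡ γᴺ-sum k n
narayanaPoly≈γᴺ-sum k zero    = trans (narayanaPoly-0 k) (sym (γᴺ-sum-0 k))
narayanaPoly≈γᴺ-sum k (suc p) with p <? k
... | no  p≮k = trans (narayanaPoly-≥ k p (≮⇒≥ p≮k)) (sym (γᴺ-sum-≥ k p (≮⇒≥ p≮k)))
... | yes p<k with m≤n⇒∃[o]m+o≡n p<k
...   | q , refl = trans (narayanaPoly-< _ p p<k) (narayana≡γᴺ-sum p q)

theorem4p9 : (k : ℕ) → .{{_ : NonZero k}} →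
    Σ (ℕ → ℕ) λ γ →
      (∀ j → 1 ≤ j → j ≤ (k + 1) / 2 →
        HasSize (λ c → DComp k j c × DnuEmpty c) (γ j))
      × (∀ j → 1 ≤ j → j ≤ (k + 1) / 2 →
        HasSize (λ c → DComp k (k ∸ j + 1) c × DoEmpty c) (γ j))
      × (narayanaPoly k ≈ₚ
          sumP 1 ((k + 1) / 2)
            (λ j → γ j ·ₚ ((tP ^ₚ j) ⊛ ((constP 1 ⊕ tP) ^ₚ (k + 1 ∸ 2 * j)))))
theorem4p9 k = γᴺ k ,
  (λ j 1≤j j≤J → card-Dnu k j 1≤j (half-bound-≤ k j 1≤j j≤J)) ,
  (λ j 1≤j j≤J → card-Do k j 1≤j (half-bound-≤ k j 1≤j j≤J)) ,
  narayanaPoly≈γᴺ-sum k
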